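{- For integers $n\ge1$, $1\le j\le2n+1$ and $1\le k\le n$ define $$\alpha_{n,j}=\frac{1}{6n+1}\cdot\frac{(4n+1)!}{((2n)!)^2}\cdot\frac{\binom{2n}{j-1}}{\binom{6n}{2n+j-1}},\qquad \beta_{n,k}=\frac{2}{6n+1}\cdot\frac{(4n+1)!}{((2n)!)^2}\cdot\frac{\binom{2n}{2k-1}}{\binom{6n}{2n+2k-1}}=2\alpha_{n,2k}.$$ Then for every $n\ge1$ and every $m=2n,2n+1,\ldots,10n-2$, $$\sum_{j=1}^{2n+1}\alpha_{n,j}\left(\binom{6n}{m-4n+j}-\binom{2n+j-2}{m-4n+j}-\binom{4n-j}{m-6n}\right)=\sum_{k=1}^n\beta_{n,k}\binom{6n}{m-4n+2k}.$$
   Context: Binomial coefficients $\binom{a}{b}$ with $a\ge0$ are taken to be $0$ when $b<0$ or $b>a$. -}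

module Defs where

open import Data.Nat as ℕ using (ℕ; zero; suc; _∸_; _^_; _!)
open import Data.Nat.Combinatorics using (_C_)
open import Data.Integer as ℤ using (ℤ; +_; -[1+_])
open import Data.Rational as ℚ using (ℚ; 0ℚ; _/_)

-- Binomial coefficient with natural top and integer bottom index;
-- 0 when the bottom index is negative (stdlib _C_ already gives 0 when k > a).
binom : ℕ → ℤ → ℕ
binom a (+ k)      = a C k
binom a -[1+ k ]   = 0

binomℚ : ℕ → ℤ → ℚ
binomℚ a k = (+ binom a k) / 1

-- the rational number p / q for naturals p, q (total: value 0 if q = 0;
-- only ever used with q ≠ 0 below)
frac : ℕ → ℕ → ℚ
frac p zero    = 0ℚ
frac p (suc q) = (+ p) / suc q

sum1to : ℕ → (ℕ → ℚ) → ℚ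
sum1to zero    f = 0ℚ
sum1to (suc N) f = sum1to N f ℚ.+ f (suc N)

α : ℕ → ℕ → ℚ
α n j = frac 1 (6 ℕ.* n ℕ.+ 1)
        ℚ.* frac ((4 ℕ.* n ℕ.+ 1) !) (((2 ℕ.* n) !) ^ 2)
        ℚ.* frac ((2 ℕ.* n) C (j ∸ 1)) ((6 ℕ.* n) C (2 ℕ.* n ℕ.+ j ∸ 1))

β : ℕ → ℕ → ℚ
β n k = frac 2 (6 ℕ.* n ℕ.+ 1)
        ℚ.* frac ((4 ℕ.* n ℕ.+ 1) !) (((2 ℕ.* n) !) ^ 2)
        ℚ.* frac ((2 ℕ.* n) C (2 ℕ.* k ∸ 1)) ((6 ℕ.* n) C (2 ℕ.* n ℕ.+ 2 ℕ.* k ∸ 1))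

zsub : ℕ → ℕ → ℤ
zsub a b = (+ a) ℤ.- (+ b)

module Submission where

open import Defs
open import Data.Nat as ℕ using (ℕ; _≤_; _∸_)
open import Data.Integer as ℤ using (+_)
open import Data.Rational as ℚ using (ℚ)
open import Relation.Binary.PropositionalEquality using (_≡_)

open import Relation.Binary.PropositionalEquality
open import Data.Nat.Combinatorics using (_C_)
import Data.Nat.Combinatorics as Comb
open import Data.Nat.DivMod using (m/n*n≡m)
import Data.Nat.Properties as ℕP
import Data.Integer.Properties as ℤP
import Data.Rational.Properties as ℚP
import Data.Nat.Tactic.RingSolver as ℕSolver
open import Data.Integer.Tactic.RingSolver using (solve-∀)
open import Data.Product using (_,_; _×_; proj₁; proj₂)
open import Data.Sum using (inj₁; inj₂)

-- Put N = 2n and w_i = C(N+i, i) C(2N-i, N).  A factorial computation gives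
-- α_{n,i+1} = κ w_i and β_{n,k+1} = 2κ w_{2k+1} for one constant κ, so the theorem is κ times an
-- identity between integers:  Σ_i w_i (B₁ - B₂ - B₃)(i) = 2 Σ_k w_{2k+1} B₁(2k+1).  Splitting
-- Σ_i w_i B₁(i) into its alternating part and twice its odd part, and reversing i ↦ N-i, this
-- becomes the three-term identity
--   Σ_i (-1)^i w_i C(3N, q-i) = Σ_i w_i C(2N-1-i, q-i) + Σ_i w_i C(2N-1-i, q-2N-1)   (all q ∈ ℤ).
-- Raising top indices by Vandermonde reduces it to the core identity, the same statement with the
-- top indices 2N+1 and N-i.  For q ≤ 2N both its alternating side and its first sum equal
-- C(2N-q, N) C(3N+1, q) (by trinomial revision, the upper Vandermonde convolution and the inverse
-- relation for (1+x)^-(N+1)), while the second sum vanishes; for q > 2N the roles swap under the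
-- symmetry q ↦ 3N+1-q.

-- Binomial coefficients on the naturals.

module _ where
  open import Data.Nat using (zero; suc; _+_; _*_; _!; _<_; z≤n; s≤s)
  open import Data.Nat.Properties using (_!≢0; _!*_!≢0)
  open ≡-Reasoning

  bin : ℕ → ℕ → ℕ
  bin n       zero    = 1
  bin zero    (suc k) = 0
  bin (suc n) (suc k) = bin n k + bin n (suc k)

  bin≡C : ∀ n k → bin n k ≡ n C k
  bin≡C n       zero    = refl
  bin≡C zero    (suc k) = refl
  bin≡C (suc n) (suc k) =
    trans (cong₂ _+_ (bin≡C n k) (bin≡C n (suc k))) (Comb.nCk+nC[k+1]≡[n+1]C[k+1] n k)

  bin-sym : ∀ n k → k ≤ n → bin n k ≡ bin n (n ∸ k)
  bin-sym n k k≤n rewrite bin≡C n k | bin≡C n (n ∸ k) = Comb.nCk≡nC[n∸k] k≤n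

  bin-sym+ : ∀ c d → bin (c + d) c ≡ bin (c + d) d
  bin-sym+ c d = trans (bin-sym (c + d) c (ℕP.m≤m+n c d)) (cong (bin (c + d)) (ℕP.m+n∸m≡n c d))

  bin-above : ∀ n k → n < k → bin n k ≡ 0
  bin-above n k n<k rewrite bin≡C n k = Comb.k>n⇒nCk≡0 n<k

  bin-diag : ∀ n → bin n n ≡ 1
  bin-diag zero    = refl
  bin-diag (suc n) rewrite bin-diag n | bin-above n (suc n) (ℕP.n<1+n n) = refl

  bin-positive : ∀ n k → k ≤ n → 0 < bin n k
  bin-positive n       zero    _         = s≤s z≤n
  bin-positive (suc n) (suc k) (s≤s k≤n) = ℕP.≤-trans (bin-positive n k k≤n) (ℕP.m≤m+n _ _)

  bin-factorial : ∀ c d → bin (c + d) c * (c ! * d !) ≡ (c + d) !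
  bin-factorial c d = subst (λ e → bin (c + d) c * (c ! * e !) ≡ (c + d) !) (ℕP.m+n∸m≡n c d) general
    where
    c≤c+d = ℕP.m≤m+n c d
    general : bin (c + d) c * (c ! * (c + d ∸ c) !) ≡ (c + d) !
    general rewrite bin≡C (c + d) c | Comb.nCk≡n!/k![n-k]! c≤c+d =
      m/n*n≡m {{c !* (c + d ∸ c) !≢0}} (Comb.k![n∸k]!∣n! c≤c+d)

  -- Trinomial revision C(c+d+e, c+d) C(c+d, c) = C(c+d+e, c) C(d+e, d): both sides times
  -- c! d! e! equal (c+d+e)!.
  trinomial-core : ∀ c d e → bin (c + d + e) (c + d) * bin (c + d) c ≡ bin (c + d + e) c * bin (d + e) d
  trinomial-core c d e = ℕP.*-cancelʳ-≡ _ _ (c ! * d ! * e !) {{nonzero}} (begin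
      bin (c + d + e) (c + d) * bin (c + d) c * (c ! * d ! * e !)
    ≡⟨ regroupˡ (bin (c + d + e) (c + d)) (bin (c + d) c) (c !) (d !) (e !) ⟩
      bin (c + d + e) (c + d) * ((bin (c + d) c * (c ! * d !)) * e !)
    ≡⟨ cong (λ z → bin (c + d + e) (c + d) * (z * e !)) (bin-factorial c d) ⟩
      bin (c + d + e) (c + d) * ((c + d) ! * e !)
    ≡⟨ bin-factorial (c + d) e ⟩
      (c + d + e) !
    ≡⟨ sym (subst (λ z → bin z c * (c ! * (d + e) !) ≡ z !) (sym (ℕP.+-assoc c d e)) (bin-factorial c (d + e))) ⟩
      bin (c + d + e) c * (c ! * (d + e) !)
    ≡⟨ cong (λ z → bin (c + d + e) c * (c ! * z)) (sym (bin-factorial d e)) ⟩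
      bin (c + d + e) c * (c ! * (bin (d + e) d * (d ! * e !)))
    ≡⟨ sym (regroupʳ (bin (c + d + e) c) (bin (d + e) d) (c !) (d !) (e !)) ⟩
      bin (c + d + e) c * bin (d + e) d * (c ! * d ! * e !) ∎)
    where
    nonzero = ℕP.m*n≢0 (c ! * d !) (e !) {{ℕP.m*n≢0 (c !) (d !) {{c !≢0}} {{d !≢0}}}} {{e !≢0}}
    regroupˡ : ∀ x y p q r → (x * y) * (p * q * r) ≡ x * ((y * (p * q)) * r)
    regroupˡ = ℕSolver.solve-∀
    regroupʳ : ∀ x y p q r → (x * y) * (p * q * r) ≡ x * (p * (y * (q * r)))
    regroupʳ = ℕSolver.solve-∀

  trinomial-revision : ∀ A b c → c ≤ b → bin A b * bin b c ≡ bin A c * bin (A ∸ c) (b ∸ c)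
  trinomial-revision A b c c≤b with ℕP.≤-<-connex b A
  ... | inj₂ A<b with ℕP.≤-<-connex c A
  ...   | inj₂ A<c rewrite bin-above A b A<b | bin-above A c A<c = refl
  ...   | inj₁ c≤A rewrite bin-above A b A<b | bin-above (A ∸ c) (b ∸ c) (ℕP.∸-monoˡ-< A<b c≤A) =
    sym (ℕP.*-zeroʳ (bin A c))
  trinomial-revision A b c c≤b | inj₁ b≤A with ℕP.m≤n⇒∃[o]m+o≡n c≤b | ℕP.m≤n⇒∃[o]m+o≡n b≤A
  ... | d , refl | e , refl rewrite ℕP.m+n∸m≡n c d
      | trans (cong (_∸ c) (ℕP.+-assoc c d e)) (ℕP.m+n∸m≡n c (d + e)) = trinomial-core c d e

  bin-factorial′ : ∀ c d → bin (c + d) d * (d ! * c !) ≡ (c + d) !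
  bin-factorial′ c d = subst (λ z → bin z d * (d ! * c !) ≡ z !) (ℕP.+-comm d c) (bin-factorial d c)

  -- With a = i + c:  C(a, i) · (3a)! = (a!)³ · C(a+i, i) C(a+c, a) · C(3a, a+i).
  -- Both sides times i! c! equal a! (3a)!, using (a+i) + (a+c) = 3a.
  binomial-ratio : ∀ i c → let a = i + c in
    bin a i * (a + a + a) ! ≡ (a ! * a ! * a !) * (bin (a + i) i * bin (a + c) a) * bin (a + a + a) (a + i)
  binomial-ratio i c = ℕP.*-cancelʳ-≡ _ _ (i ! * c !) {{ℕP.m*n≢0 (i !) (c !) {{i !≢0}} {{c !≢0}}}} (begin
      bin a i * (a + a + a) ! * (i ! * c !)
    ≡⟨ move (bin a i) ((a + a + a) !) (i !) (c !) ⟩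
      (bin a i * (i ! * c !)) * (a + a + a) !
    ≡⟨ cong (_* (a + a + a) !) (bin-factorial i c) ⟩
      a ! * (a + a + a) !
    ≡⟨ cong (a ! *_) (sym (subst (λ z → bin z (a + i) * ((a + i) ! * (a + c) !) ≡ z !) 3a (bin-factorial (a + i) (a + c)))) ⟩
      a ! * (bin (a + a + a) (a + i) * ((a + i) ! * (a + c) !))
    ≡⟨ cong₂ (λ x y → a ! * (bin (a + a + a) (a + i) * (x * y))) (sym (bin-factorial′ a i)) (sym (bin-factorial a c)) ⟩
      a ! * (bin (a + a + a) (a + i) * ((bin (a + i) i * (i ! * a !)) * (bin (a + c) a * (a ! * c !))))
    ≡⟨ collect (a !) (bin (a + a + a) (a + i)) (bin (a + i) i) (i !) (bin (a + c) a) (c !) ⟩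
      (a ! * a ! * a !) * (bin (a + i) i * bin (a + c) a) * bin (a + a + a) (a + i) * (i ! * c !) ∎)
    where
    a = i + c
    3a : (a + i) + (a + c) ≡ a + a + a
    3a = regroup i c
      where
      regroup : ∀ i c → (i + c + i) + (i + c + c) ≡ (i + c) + (i + c) + (i + c)
      regroup = ℕSolver.solve-∀
    move : ∀ x y p q → x * y * (p * q) ≡ (x * (p * q)) * y
    move = ℕSolver.solve-∀
    collect : ∀ A B X p Y q → A * (B * ((X * (p * A)) * (Y * (A * q)))) ≡ (A * A * A) * (X * Y) * B * (p * q)
    collect = ℕSolver.solve-∀

module _ where
  open import Data.Nat using (zero; suc; _<_; z≤n; s≤s)
  open import Data.Integer using (ℤ; -[1+_]; _+_; _*_; -_; _-_; 0ℤ; 1ℤ)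

  Cℤ : ℕ → ℤ → ℤ
  Cℤ n (+ k)    = + bin n k
  Cℤ n -[1+ k ] = 0ℤ

  Cℤ-pascal : ∀ n r → Cℤ (suc n) r ≡ Cℤ n (r - 1ℤ) + Cℤ n r
  Cℤ-pascal n (+ zero)  = refl
  Cℤ-pascal n (+ suc k) = ℤP.pos-+ (bin n k) (bin n (suc k))
  Cℤ-pascal n -[1+ k ]  = refl

  pos-∸ : ∀ a b → b ≤ a → + (a ∸ b) ≡ + a - + b
  pos-∸ a b b≤a = sym (trans (ℤP.m-n≡m⊖n a b) (ℤP.⊖-≥ b≤a))

  Cℤ-above : ∀ n k → n < k → Cℤ n (+ k) ≡ 0ℤ
  Cℤ-above n k n<k = cong +_ (bin-above n k n<k)

  Cℤ-negative : ∀ n p q → p < q → Cℤ n (+ p - + q) ≡ 0ℤ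
  Cℤ-negative n p q p<q rewrite ℤP.m-n≡m⊖n p q | ℤP.⊖-< p<q with q ∸ p | ℕP.m<n⇒0<n∸m p<q
  ... | suc _ | _ = refl

  Cℤ-too-large : ∀ n p q → n ℕ.+ q < p → Cℤ n (+ p - + q) ≡ 0ℤ
  Cℤ-too-large n p q lt rewrite sym (pos-∸ p q (ℕP.≤-trans (ℕP.m≤n+m q n) (ℕP.<⇒≤ lt))) =
    Cℤ-above n (p ∸ q) (ℕP.m+n≤o⇒m≤o∸n (suc n) lt)

  Cℤ-negsuc : ∀ n m i → Cℤ n (-[1+ m ] - + i) ≡ 0ℤ
  Cℤ-negsuc n m zero    = refl
  Cℤ-negsuc n m (suc i) = refl

  Cℤ-reflect : ∀ n r → Cℤ n r ≡ Cℤ n (+ n - r)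
  Cℤ-reflect n (+ k) with ℕP.≤-<-connex k n
  ... | inj₁ k≤n rewrite sym (pos-∸ n k k≤n) = cong +_ (bin-sym n k k≤n)
  ... | inj₂ n<k rewrite bin-above n k n<k = sym (Cℤ-negative n n k n<k)
  Cℤ-reflect n -[1+ k ] = sym (Cℤ-above n (n ℕ.+ suc k) (ℕP.m<m+n n (s≤s z≤n)))

  *-vanishʳ : ∀ x {y} → y ≡ 0ℤ → x * y ≡ 0ℤ
  *-vanishʳ x refl = ℤP.*-zeroʳ x

  *-vanishˡ : ∀ {x} y → x ≡ 0ℤ → x * y ≡ 0ℤ
  *-vanishˡ y refl = refl

  ∑ : ℕ → (ℕ → ℤ) → ℤ
  ∑ zero    f = 0ℤ
  ∑ (suc n) f = ∑ n f + f n

  ∑-cong : ∀ n {f g : ℕ → ℤ} → (∀ i → i < n → f i ≡ g i) → ∑ n f ≡ ∑ n g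
  ∑-cong zero    h = refl
  ∑-cong (suc n) h = cong₂ _+_ (∑-cong n (λ i i<n → h i (ℕP.m<n⇒m<1+n i<n))) (h n ℕP.≤-refl)

  ∑-zero : ∀ n {f : ℕ → ℤ} → (∀ i → i < n → f i ≡ 0ℤ) → ∑ n f ≡ 0ℤ
  ∑-zero zero    h = refl
  ∑-zero (suc n) h rewrite ∑-zero n (λ i i<n → h i (ℕP.m<n⇒m<1+n i<n)) | h n ℕP.≤-refl = refl

  ∑-+ : ∀ n (f g : ℕ → ℤ) → ∑ n (λ i → f i + g i) ≡ ∑ n f + ∑ n g
  ∑-+ zero    f g = refl
  ∑-+ (suc n) f g rewrite ∑-+ n f g = interchange (∑ n f) (∑ n g) (f n) (g n)
    where
    interchange : ∀ a b c d → (a + b) + (c + d) ≡ (a + c) + (b + d)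
    interchange = solve-∀

  ∑-neg : ∀ n (f : ℕ → ℤ) → ∑ n (λ i → - f i) ≡ - ∑ n f
  ∑-neg zero    f = refl
  ∑-neg (suc n) f rewrite ∑-neg n f = sym (ℤP.neg-distrib-+ (∑ n f) (f n))

  ∑-- : ∀ n (f g : ℕ → ℤ) → ∑ n (λ i → f i - g i) ≡ ∑ n f - ∑ n g
  ∑-- n f g = trans (∑-+ n f (λ i → - g i)) (cong (λ z → ∑ n f + z) (∑-neg n g))

  ∑-*ˡ : ∀ n c (f : ℕ → ℤ) → ∑ n (λ i → c * f i) ≡ c * ∑ n f
  ∑-*ˡ zero    c f = sym (ℤP.*-zeroʳ c)
  ∑-*ˡ (suc n) c f rewrite ∑-*ˡ n c f = sym (ℤP.*-distribˡ-+ c (∑ n f) (f n))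

  ∑-*ʳ : ∀ n (f : ℕ → ℤ) c → ∑ n f * c ≡ ∑ n (λ i → f i * c)
  ∑-*ʳ n f c = trans (ℤP.*-comm (∑ n f) c) (trans (sym (∑-*ˡ n c f)) (∑-cong n (λ i _ → ℤP.*-comm c (f i))))

  ∑-first : ∀ n (f : ℕ → ℤ) → ∑ (suc n) f ≡ f 0 + ∑ n (λ i → f (suc i))
  ∑-first zero    f = ℤP.+-comm 0ℤ (f 0)
  ∑-first (suc n) f rewrite ∑-first n f = ℤP.+-assoc (f 0) _ _

  ∑-swap : ∀ n m (f : ℕ → ℕ → ℤ) → ∑ n (λ i → ∑ m (f i)) ≡ ∑ m (λ j → ∑ n (λ i → f i j))
  ∑-swap zero    m f = sym (∑-zero m (λ _ _ → refl))
  ∑-swap (suc n) m f rewrite ∑-swap n m f = sym (∑-+ m (λ j → ∑ n (λ i → f i j)) (f n))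

  ∑-reverse : ∀ n (f : ℕ → ℤ) → ∑ n f ≡ ∑ n (λ i → f (n ∸ suc i))
  ∑-reverse zero    f = refl
  ∑-reverse (suc n) f = begin
      ∑ n f + f n                             ≡⟨ cong (_+ f n) (∑-reverse n f) ⟩
      ∑ n (λ i → f (n ∸ suc i)) + f n         ≡⟨ ℤP.+-comm _ (f n) ⟩
      f n + ∑ n (λ i → f (n ∸ suc i))         ≡⟨ sym (∑-first n (λ i → f (suc n ∸ suc i))) ⟩
      ∑ (suc n) (λ i → f (suc n ∸ suc i))     ∎
    where open ≡-Reasoning

  ∑-extend : ∀ n m {f : ℕ → ℤ} → n ≤ m → (∀ i → n ≤ i → f i ≡ 0ℤ) → ∑ m f ≡ ∑ n f
  ∑-extend n m {f} n≤m h with ℕP.m≤n⇒∃[o]m+o≡n n≤m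
  ... | k , refl = go k
    where
    go : ∀ k → ∑ (n ℕ.+ k) f ≡ ∑ n f
    go zero    rewrite ℕP.+-identityʳ n = refl
    go (suc k) rewrite ℕP.+-suc n k | go k | h (n ℕ.+ k) (ℕP.m≤m+n n k) = ℤP.+-identityʳ _

-- Classical convolution identities.

module _ where
  open import Data.Nat using (zero; suc)
  open import Data.Integer using (ℤ; _+_; _*_; -_; _-_; 0ℤ; 1ℤ)
  open ≡-Reasoning

  vandermonde : ∀ m n r → ∑ (suc m) (λ t → Cℤ m (+ t) * Cℤ n (r - + t)) ≡ Cℤ (m ℕ.+ n) r
  vandermonde zero    n r = trans (ℤP.+-identityˡ _) (trans (ℤP.*-identityˡ _) (cong (Cℤ n) (ℤP.+-identityʳ r)))
  vandermonde (suc m) n r = begin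
      ∑ (suc (suc m)) (λ t → Cℤ (suc m) (+ t) * X t)
    ≡⟨ ∑-cong (suc (suc m)) (λ t _ → trans (cong (_* X t) (Cℤ-pascal m (+ t))) (ℤP.*-distribʳ-+ (X t) (Cℤ m (+ t - 1ℤ)) (Cℤ m (+ t)))) ⟩
      ∑ (suc (suc m)) (λ t → Cℤ m (+ t - 1ℤ) * X t + Cℤ m (+ t) * X t)
    ≡⟨ ∑-+ (suc (suc m)) _ _ ⟩
      ∑ (suc (suc m)) (λ t → Cℤ m (+ t - 1ℤ) * X t) + ∑ (suc (suc m)) (λ t → Cℤ m (+ t) * X t)
    ≡⟨ cong₂ _+_ shifted unshifted ⟩
      Cℤ (m ℕ.+ n) (r - 1ℤ) + Cℤ (m ℕ.+ n) r
    ≡⟨ sym (Cℤ-pascal (m ℕ.+ n) r) ⟩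
      Cℤ (suc m ℕ.+ n) r ∎
    where
    X : ℕ → ℤ
    X t = Cℤ n (r - + t)
    unshifted : ∑ (suc (suc m)) (λ t → Cℤ m (+ t) * X t) ≡ Cℤ (m ℕ.+ n) r
    unshifted = trans (∑-extend (suc m) (suc (suc m)) (ℕP.n≤1+n _)
                        (λ t m<t → *-vanishˡ (X t) (Cℤ-above m t m<t)))
                      (vandermonde m n r)
    shifted : ∑ (suc (suc m)) (λ t → Cℤ m (+ t - 1ℤ) * X t) ≡ Cℤ (m ℕ.+ n) (r - 1ℤ)
    shifted = begin
        ∑ (suc (suc m)) (λ t → Cℤ m (+ t - 1ℤ) * X t)
      ≡⟨ trans (∑-first (suc m) _) (ℤP.+-identityˡ _) ⟩
        ∑ (suc m) (λ t → Cℤ m (+ t) * X (suc t))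
      ≡⟨ ∑-cong (suc m) (λ t _ → cong (λ z → Cℤ m (+ t) * Cℤ n z) (index r (+ t))) ⟩
        ∑ (suc m) (λ t → Cℤ m (+ t) * Cℤ n ((r - 1ℤ) - + t))
      ≡⟨ vandermonde m n (r - 1ℤ) ⟩
        Cℤ (m ℕ.+ n) (r - 1ℤ) ∎
      where
      index : ∀ r t → r - (1ℤ + t) ≡ (r - 1ℤ) - t
      index = solve-∀

  mset : ℕ → ℕ → ℤ
  mset a i = + bin (a ℕ.+ i) i

  mset-zero : ∀ i → mset 0 i ≡ 1ℤ
  mset-zero i rewrite bin-diag i = refl

  mset-pascal : ∀ a i → mset (suc a) (suc i) ≡ mset a (suc i) + mset (suc a) i
  mset-pascal a i = trans (ℤP.pos-+ (bin (a ℕ.+ suc i) i) (bin (a ℕ.+ suc i) (suc i)))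
    (trans (cong (λ z → + bin z i + mset a (suc i)) (ℕP.+-suc a i)) (ℤP.+-comm (mset (suc a) i) (mset a (suc i))))

  _⋆_ : (ℕ → ℤ) → (ℕ → ℤ) → ℕ → ℤ
  (f ⋆ g) k = ∑ (suc k) (λ i → f i * g (k ∸ i))

  ⋆-first : ∀ f g k → (f ⋆ g) (suc k) ≡ f 0 * g (suc k) + ∑ (suc k) (λ i → f (suc i) * g (k ∸ i))
  ⋆-first f g k = ∑-first (suc k) (λ i → f i * g (suc k ∸ i))

  upper-vandermonde : ∀ a b k → (mset a ⋆ mset b) k ≡ mset (suc (a ℕ.+ b)) k
  upper-vandermonde zero    b zero    = refl
  upper-vandermonde zero    b (suc k) = begin
      (mset 0 ⋆ mset b) (suc k)
    ≡⟨ ⋆-first (mset 0) (mset b) k ⟩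
      1ℤ * mset b (suc k) + ∑ (suc k) (λ i → mset 0 (suc i) * mset b (k ∸ i))
    ≡⟨ cong₂ _+_ (ℤP.*-identityˡ (mset b (suc k)))
         (∑-cong (suc k) (λ i _ → cong (_* mset b (k ∸ i)) (trans (mset-zero (suc i)) (sym (mset-zero i))))) ⟩
      mset b (suc k) + (mset 0 ⋆ mset b) k
    ≡⟨ cong (λ z → mset b (suc k) + z) (upper-vandermonde zero b k) ⟩
      mset b (suc k) + mset (suc b) k
    ≡⟨ sym (mset-pascal b k) ⟩
      mset (suc b) (suc k) ∎
  upper-vandermonde (suc a) b zero    = refl
  upper-vandermonde (suc a) b (suc k) = begin
      (mset (suc a) ⋆ mset b) (suc k)
    ≡⟨ ⋆-first (mset (suc a)) (mset b) k ⟩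
      h + ∑ (suc k) (λ i → mset (suc a) (suc i) * mset b (k ∸ i))
    ≡⟨ cong (λ z → h + z) (∑-cong (suc k) (λ i _ → trans (cong (_* mset b (k ∸ i)) (mset-pascal a i))
                                                    (ℤP.*-distribʳ-+ (mset b (k ∸ i)) (mset a (suc i)) (mset (suc a) i)))) ⟩
      h + ∑ (suc k) (λ i → mset a (suc i) * mset b (k ∸ i) + mset (suc a) i * mset b (k ∸ i))
    ≡⟨ cong (λ z → h + z) (∑-+ (suc k) (λ i → mset a (suc i) * mset b (k ∸ i)) (λ i → mset (suc a) i * mset b (k ∸ i))) ⟩
      h + (∑ (suc k) (λ i → mset a (suc i) * mset b (k ∸ i)) + (mset (suc a) ⋆ mset b) k)
    ≡⟨ sym (ℤP.+-assoc h _ _) ⟩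
      (h + ∑ (suc k) (λ i → mset a (suc i) * mset b (k ∸ i))) + (mset (suc a) ⋆ mset b) k
    ≡⟨ cong (_+ (mset (suc a) ⋆ mset b) k) (sym (⋆-first (mset a) (mset b) k)) ⟩
      (mset a ⋆ mset b) (suc k) + (mset (suc a) ⋆ mset b) k
    ≡⟨ cong₂ _+_ (upper-vandermonde a b (suc k)) (upper-vandermonde (suc a) b k) ⟩
      mset (suc (a ℕ.+ b)) (suc k) + mset (suc (suc a ℕ.+ b)) k
    ≡⟨ sym (mset-pascal (suc (a ℕ.+ b)) k) ⟩
      mset (suc (suc a ℕ.+ b)) (suc k) ∎
    where
    h = 1ℤ * mset b (suc k)

  sign : ℕ → ℤ
  sign zero    = 1ℤ
  sign (suc i) = - sign i

  sign-+ : ∀ a b → sign (a ℕ.+ b) ≡ sign a * sign b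
  sign-+ zero    b = sym (ℤP.*-identityˡ (sign b))
  sign-+ (suc a) b rewrite sign-+ a b = ℤP.neg-distribˡ-* (sign a) (sign b)

  sign-square : ∀ a → sign a * sign a ≡ 1ℤ
  sign-square zero    = refl
  sign-square (suc a) = trans (neg-square (sign a)) (sign-square a)
    where
    neg-square : ∀ s → - s * - s ≡ s * s
    neg-square = solve-∀

  sign-even : ∀ a → sign (a ℕ.+ a) ≡ 1ℤ
  sign-even a = trans (sign-+ a a) (sign-square a)

  sign-reflect : ∀ n i → i ≤ n ℕ.+ n → sign (n ℕ.+ n ∸ i) ≡ sign i
  sign-reflect n i i≤2n = begin
      sign (n ℕ.+ n ∸ i)                        ≡⟨ sym (ℤP.*-identityʳ _) ⟩
      sign (n ℕ.+ n ∸ i) * 1ℤ                   ≡⟨ cong (sign (n ℕ.+ n ∸ i) *_) (sym (sign-square i)) ⟩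
      sign (n ℕ.+ n ∸ i) * (sign i * sign i)    ≡⟨ sym (ℤP.*-assoc (sign (n ℕ.+ n ∸ i)) (sign i) (sign i)) ⟩
      sign (n ℕ.+ n ∸ i) * sign i * sign i      ≡⟨ cong (_* sign i) (sym (sign-+ (n ℕ.+ n ∸ i) i)) ⟩
      sign (n ℕ.+ n ∸ i ℕ.+ i) * sign i         ≡⟨ cong (λ z → sign z * sign i) (ℕP.m∸n+n≡m i≤2n) ⟩
      sign (n ℕ.+ n) * sign i                   ≡⟨ cong (_* sign i) (sign-even n) ⟩
      1ℤ * sign i                               ≡⟨ ℤP.*-identityˡ (sign i) ⟩
      sign i                                    ∎

  shift : (ℕ → ℤ) → ℕ → ℤ
  shift u zero    = 0ℤ
  shift u (suc i) = u i

  -- Summation by parts against Pascal's rule: lowering the top index n+1 to n turns the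
  -- coefficients u into u + shift u, provided the boundary term vanishes.
  lower-top : ∀ R (u : ℕ → ℤ) n r → shift u R * Cℤ n (r - + R) ≡ 0ℤ →
    ∑ R (λ i → u i * Cℤ (suc n) (r - + i)) ≡ ∑ R (λ i → (u i + shift u i) * Cℤ n (r - + i))
  lower-top R u n r boundary = begin
      ∑ R (λ i → u i * Cℤ (suc n) (r - + i))
    ≡⟨ ∑-cong R (λ i _ → trans (cong (u i *_) (Cℤ-pascal n (r - + i)))
                              (ℤP.*-distribˡ-+ (u i) (Cℤ n (r - + i - 1ℤ)) (Cℤ n (r - + i)))) ⟩
      ∑ R (λ i → u i * Cℤ n (r - + i - 1ℤ) + u i * Cℤ n (r - + i))
    ≡⟨ ∑-+ R _ _ ⟩
      ∑ R (λ i → u i * Cℤ n (r - + i - 1ℤ)) + ∑ R (λ i → u i * Cℤ n (r - + i))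
    ≡⟨ cong (_+ ∑ R (λ i → u i * Cℤ n (r - + i))) shifted ⟩
      ∑ R (λ i → shift u i * Cℤ n (r - + i)) + ∑ R (λ i → u i * Cℤ n (r - + i))
    ≡⟨ sym (∑-+ R _ _) ⟩
      ∑ R (λ i → shift u i * Cℤ n (r - + i) + u i * Cℤ n (r - + i))
    ≡⟨ ∑-cong R (λ i _ → trans (sym (ℤP.*-distribʳ-+ (Cℤ n (r - + i)) (shift u i) (u i)))
                              (cong (_* Cℤ n (r - + i)) (ℤP.+-comm (shift u i) (u i)))) ⟩
      ∑ R (λ i → (u i + shift u i) * Cℤ n (r - + i)) ∎
    where
    index : ∀ r t → r - t - 1ℤ ≡ r - (1ℤ + t)
    index = solve-∀
    shifted : ∑ R (λ i → u i * Cℤ n (r - + i - 1ℤ)) ≡ ∑ R (λ i → shift u i * Cℤ n (r - + i))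
    shifted = begin
        ∑ R (λ i → u i * Cℤ n (r - + i - 1ℤ))
      ≡⟨ ∑-cong R (λ i _ → cong (λ z → u i * Cℤ n z) (index r (+ i))) ⟩
        ∑ R (λ i → shift u (suc i) * Cℤ n (r - + suc i))
      ≡⟨ sym (ℤP.+-identityˡ _) ⟩
        0ℤ + ∑ R (λ i → shift u (suc i) * Cℤ n (r - + suc i))
      ≡⟨ sym (∑-first R (λ i → shift u i * Cℤ n (r - + i))) ⟩
        ∑ R (λ i → shift u i * Cℤ n (r - + i)) + shift u R * Cℤ n (r - + R)
      ≡⟨ cong (λ z → ∑ R (λ i → shift u i * Cℤ n (r - + i)) + z) boundary ⟩
        ∑ R (λ i → shift u i * Cℤ n (r - + i)) + 0ℤ
      ≡⟨ ℤP.+-identityʳ _ ⟩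
        ∑ R (λ i → shift u i * Cℤ n (r - + i)) ∎

  -- alt a i = (-1)^i C(a+i, i): the coefficients of (1+x)^-(a+1).
  alt : ℕ → ℕ → ℤ
  alt a i = sign i * mset a i

  δ₀ : ℕ → ℤ
  δ₀ zero    = 1ℤ
  δ₀ (suc i) = 0ℤ

  -- Multiplying by 1 + x: the coefficients of (1+x)^-1 · (1+x) = 1 ...
  alt-base : ∀ i → alt 0 i + shift (alt 0) i ≡ δ₀ i
  alt-base zero    = refl
  alt-base (suc i) rewrite bin-diag (suc i) | bin-diag i = cancel (sign i)
    where
    cancel : ∀ s → - s * 1ℤ + s * 1ℤ ≡ 0ℤ
    cancel = solve-∀

  -- ... and of (1+x)^-(a+2) · (1+x) = (1+x)^-(a+1).
  alt-step : ∀ a i → alt (suc a) i + shift (alt (suc a)) i ≡ alt a i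
  alt-step a zero    = refl
  alt-step a (suc i) rewrite ℕP.+-suc a i | ℤP.pos-+ (bin (suc (a ℕ.+ i)) i) (bin (suc (a ℕ.+ i)) (suc i)) =
    collect (sign i) (+ bin (suc (a ℕ.+ i)) i) (+ bin (suc (a ℕ.+ i)) (suc i))
    where
    collect : ∀ s p q → - s * (p + q) + s * p ≡ - s * q
    collect = solve-∀

  -- Inverse relation: Σ_{i<R} (-1)^i C(a+i,i) C(a+1+j, r-i) = C(j, r), i.e. multiplying
  -- (1+x)^(a+1+j) by (1+x)^-(a+1); the truncation at R is harmless when C(·, r-R) = 0.
  inverse-relation : ∀ a j R r → (∀ n → Cℤ n (r - + R) ≡ 0ℤ) →
    ∑ R (λ i → alt a i * Cℤ (a ℕ.+ suc j) (r - + i)) ≡ Cℤ j r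
  inverse-relation zero    j R r vanish = begin
      ∑ R (λ i → alt 0 i * Cℤ (suc j) (r - + i))
    ≡⟨ lower-top R (alt 0) j r (*-vanishʳ (shift (alt 0) R) (vanish j)) ⟩
      ∑ R (λ i → (alt 0 i + shift (alt 0) i) * Cℤ j (r - + i))
    ≡⟨ ∑-cong R (λ i _ → cong (_* Cℤ j (r - + i)) (alt-base i)) ⟩
      ∑ R (λ i → δ₀ i * Cℤ j (r - + i))
    ≡⟨ first-only R (vanish j) ⟩
      Cℤ j (r - + 0)
    ≡⟨ cong (Cℤ j) (ℤP.+-identityʳ r) ⟩
      Cℤ j r ∎
    where
    first-only : ∀ R → Cℤ j (r - + R) ≡ 0ℤ → ∑ R (λ i → δ₀ i * Cℤ j (r - + i)) ≡ Cℤ j (r - + 0)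
    first-only zero    h = sym h
    first-only (suc R) _ = begin
        ∑ (suc R) (λ i → δ₀ i * Cℤ j (r - + i))
      ≡⟨ ∑-first R (λ i → δ₀ i * Cℤ j (r - + i)) ⟩
        1ℤ * Cℤ j (r - + 0) + ∑ R (λ _ → 0ℤ)
      ≡⟨ cong₂ _+_ (ℤP.*-identityˡ (Cℤ j (r - + 0))) (∑-zero R (λ _ _ → refl)) ⟩
        Cℤ j (r - + 0) + 0ℤ
      ≡⟨ ℤP.+-identityʳ _ ⟩
        Cℤ j (r - + 0) ∎
  inverse-relation (suc a) j R r vanish = begin
      ∑ R (λ i → alt (suc a) i * Cℤ (suc (a ℕ.+ suc j)) (r - + i))
    ≡⟨ lower-top R (alt (suc a)) (a ℕ.+ suc j) r (*-vanishʳ (shift (alt (suc a)) R) (vanish _)) ⟩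
      ∑ R (λ i → (alt (suc a) i + shift (alt (suc a)) i) * Cℤ (a ℕ.+ suc j) (r - + i))
    ≡⟨ ∑-cong R (λ i _ → cong (_* Cℤ (a ℕ.+ suc j) (r - + i)) (alt-step a i)) ⟩
      ∑ R (λ i → alt a i * Cℤ (a ℕ.+ suc j) (r - + i))
    ≡⟨ inverse-relation a j R r vanish ⟩
      Cℤ j r ∎

module _ where
  open import Data.Nat using (zero; suc; _<_; z≤n; s≤s)
  open import Data.Integer using (ℤ; -[1+_]; _+_; _*_; -_; _-_; 0ℤ; 1ℤ)
  open ≡-Reasoning

  -- w_i = C(N+i, i) C(2N-i, N); for even N these are, up to a constant, the α_{n,i+1}.
  weight : ℕ → ℕ → ℤ
  weight N i = mset N i * + bin (N ℕ.+ N ∸ i) N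

  closed : ℕ → ℕ → ℤ
  closed N k = + (bin (N ℕ.+ N ∸ k) N ℕ.* bin (suc (N ℕ.+ N ℕ.+ N)) k)

  altSum lowSum highSum : ℕ → ℤ → ℤ
  altSum  N q = ∑ (suc N) (λ i → (sign i * weight N i) * Cℤ (suc (N ℕ.+ N)) (q - + i))
  lowSum  N q = ∑ (suc N) (λ i → weight N i * Cℤ (N ∸ i) (q - + i))
  highSum N q = ∑ (suc N) (λ i → weight N i * Cℤ (N ∸ i) (q - + suc (N ℕ.+ N)))

  -- For k > N ≥ 1 we have 2N - k < N, so C(2N-k, N) = 0 and the closed form and the weights vanish.
  2N-k<N : ∀ N k → 1 ≤ N → N < k → N ℕ.+ N ∸ k < N
  2N-k<N (suc N) k _ N<k = ℕP.m<n+o⇒m∸n<o (suc N ℕ.+ suc N) k (ℕP.+-monoˡ-< (suc N) N<k)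

  closed-vanishes : ∀ N k → 1 ≤ N → N < k → closed N k ≡ 0ℤ
  closed-vanishes N k 1≤N N<k rewrite bin-above (N ℕ.+ N ∸ k) N (2N-k<N N k 1≤N N<k) = refl

  weight-vanishes : ∀ N i → 1 ≤ N → N < i → weight N i ≡ 0ℤ
  weight-vanishes N i 1≤N N<i = *-vanishʳ (mset N i) (Cℤ-above (N ℕ.+ N ∸ i) N (2N-k<N N i 1≤N N<i))

  double-∸ : ∀ a e f → e ℕ.+ f ≡ a → a ℕ.+ a ∸ e ≡ a ℕ.+ f
  double-∸ .(e ℕ.+ f) e f refl =
    trans (ℕP.+-∸-assoc (e ℕ.+ f) (ℕP.m≤m+n e f)) (cong (e ℕ.+ f ℕ.+_) (ℕP.m+n∸m≡n e f))

  weight-reflect : ∀ N i → i ≤ N → weight N (N ∸ i) ≡ weight N i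
  weight-reflect N i i≤N with ℕP.m≤n⇒∃[o]m+o≡n i≤N
  ... | d , refl rewrite ℕP.m+n∸m≡n i d
                        | double-∸ (i ℕ.+ d) d i (ℕP.+-comm d i) | double-∸ (i ℕ.+ d) i d refl =
    trans (cong₂ (λ x y → + x * + y) (sym (bin-sym+ (i ℕ.+ d) d)) (bin-sym+ (i ℕ.+ d) i))
          (ℤP.*-comm (+ bin (i ℕ.+ d ℕ.+ d) (i ℕ.+ d)) (+ bin (i ℕ.+ d ℕ.+ i) i))


  lowSum-revision : ∀ b c N → bin (b ℕ.+ c ℕ.+ N) N ℕ.* bin (b ℕ.+ c) b ≡ bin (c ℕ.+ N) N ℕ.* bin (c ℕ.+ N ℕ.+ b) b
  lowSum-revision b c N = begin
      bin (b ℕ.+ c ℕ.+ N) N ℕ.* bin (b ℕ.+ c) b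
    ≡⟨ cong (ℕ._* bin (b ℕ.+ c) b) (sym (bin-sym+ (b ℕ.+ c) N)) ⟩
      bin (b ℕ.+ c ℕ.+ N) (b ℕ.+ c) ℕ.* bin (b ℕ.+ c) b
    ≡⟨ trinomial-revision (b ℕ.+ c ℕ.+ N) (b ℕ.+ c) b (ℕP.m≤m+n b c) ⟩
      bin (b ℕ.+ c ℕ.+ N) b ℕ.* bin (b ℕ.+ c ℕ.+ N ∸ b) (b ℕ.+ c ∸ b)
    ≡⟨ cong₂ (λ x y → bin (b ℕ.+ c ℕ.+ N) b ℕ.* bin x y) drop-b (ℕP.m+n∸m≡n b c) ⟩
      bin (b ℕ.+ c ℕ.+ N) b ℕ.* bin (c ℕ.+ N) c
    ≡⟨ cong₂ (λ x y → bin x b ℕ.* y) (rotate b c N) (bin-sym+ c N) ⟩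
      bin (c ℕ.+ N ℕ.+ b) b ℕ.* bin (c ℕ.+ N) N
    ≡⟨ ℕP.*-comm (bin (c ℕ.+ N ℕ.+ b) b) (bin (c ℕ.+ N) N) ⟩
      bin (c ℕ.+ N) N ℕ.* bin (c ℕ.+ N ℕ.+ b) b ∎
    where
    drop-b : b ℕ.+ c ℕ.+ N ∸ b ≡ c ℕ.+ N
    drop-b = trans (cong (_∸ b) (ℕP.+-assoc b c N)) (ℕP.m+n∸m≡n b (c ℕ.+ N))
    rotate : ∀ b c N → b ℕ.+ c ℕ.+ N ≡ c ℕ.+ N ℕ.+ b
    rotate = ℕSolver.solve-∀

  lowSum-term : ∀ N k i → i ≤ k → k ≤ N →
    weight N i * Cℤ (N ∸ i) (+ k - + i) ≡ + bin (N ℕ.+ N ∸ k) N * (mset N i * mset (N ℕ.+ N ∸ k) (k ∸ i))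
  lowSum-term N k i i≤k k≤N with ℕP.m≤n⇒∃[o]m+o≡n i≤k | ℕP.m≤n⇒∃[o]m+o≡n k≤N
  ... | b , refl | c , refl = begin
      (mset N i * + bin (N ℕ.+ N ∸ i) N) * Cℤ (N ∸ i) (+ (i ℕ.+ b) - + i)
    ≡⟨ cong (λ z → (mset N i * + bin (N ℕ.+ N ∸ i) N) * Cℤ (N ∸ i) z) (sym (pos-∸ (i ℕ.+ b) i (ℕP.m≤m+n i b))) ⟩
      (mset N i * + bin (N ℕ.+ N ∸ i) N) * + bin (N ∸ i) (i ℕ.+ b ∸ i)
    ≡⟨ rewrite-indices e1 e2 (ℕP.m+n∸m≡n i b) ⟩
      (mset N i * + bin (b ℕ.+ c ℕ.+ N) N) * + bin (b ℕ.+ c) b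
    ≡⟨ trans (ℤP.*-assoc (mset N i) _ _) (cong (mset N i *_) (sym (ℤP.pos-* (bin (b ℕ.+ c ℕ.+ N) N) _))) ⟩
      mset N i * + (bin (b ℕ.+ c ℕ.+ N) N ℕ.* bin (b ℕ.+ c) b)
    ≡⟨ cong (λ z → mset N i * + z) (lowSum-revision b c N) ⟩
      mset N i * + (bin (c ℕ.+ N) N ℕ.* bin (c ℕ.+ N ℕ.+ b) b)
    ≡⟨ trans (cong (mset N i *_) (ℤP.pos-* (bin (c ℕ.+ N) N) _)) (swap (mset N i) (+ bin (c ℕ.+ N) N) _) ⟩
      + bin (c ℕ.+ N) N * (mset N i * mset (c ℕ.+ N) b)
    ≡⟨ cong₂ (λ x y → + bin x N * (mset N i * mset x y)) (sym e4) (sym (ℕP.m+n∸m≡n i b)) ⟩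
      + bin (N ℕ.+ N ∸ (i ℕ.+ b)) N * (mset N i * mset (N ℕ.+ N ∸ (i ℕ.+ b)) (i ℕ.+ b ∸ i)) ∎
    where
    swap : ∀ x p q → x * (p * q) ≡ p * (x * q)
    swap = solve-∀
    e1 : N ℕ.+ N ∸ i ≡ b ℕ.+ c ℕ.+ N
    e1 = trans (cong (_∸ i) (regroup i b c)) (ℕP.m+n∸m≡n i (b ℕ.+ c ℕ.+ N))
      where
      regroup : ∀ i b c → (i ℕ.+ b ℕ.+ c) ℕ.+ (i ℕ.+ b ℕ.+ c) ≡ i ℕ.+ (b ℕ.+ c ℕ.+ (i ℕ.+ b ℕ.+ c))
      regroup = ℕSolver.solve-∀
    e2 : N ∸ i ≡ b ℕ.+ c
    e2 = trans (cong (_∸ i) (ℕP.+-assoc i b c)) (ℕP.m+n∸m≡n i (b ℕ.+ c))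
    e4 : N ℕ.+ N ∸ (i ℕ.+ b) ≡ c ℕ.+ N
    e4 = trans (cong (_∸ (i ℕ.+ b)) (ℕP.+-assoc (i ℕ.+ b) c N)) (ℕP.m+n∸m≡n (i ℕ.+ b) (c ℕ.+ N))
    rewrite-indices : N ℕ.+ N ∸ i ≡ b ℕ.+ c ℕ.+ N → N ∸ i ≡ b ℕ.+ c → i ℕ.+ b ∸ i ≡ b →
       (mset N i * + bin (N ℕ.+ N ∸ i) N) * + bin (N ∸ i) (i ℕ.+ b ∸ i)
       ≡ (mset N i * + bin (b ℕ.+ c ℕ.+ N) N) * + bin (b ℕ.+ c) b
    rewrite-indices p q r rewrite p | q | r = refl

  i<1+n⇒i≤n : ∀ {i n} → i < suc n → i ≤ n
  i<1+n⇒i≤n (s≤s i≤n) = i≤n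

  -- Σ_i w_i C(N-i, k-i) = C(2N-k, N) C(3N+1, k): trinomial revision and upper Vandermonde.
  lowSum-closed : ∀ N k → 1 ≤ N → lowSum N (+ k) ≡ closed N k
  lowSum-closed N k 1≤N with ℕP.≤-<-connex k N
  ... | inj₂ N<k = trans (∑-zero (suc N) (λ i i≤N → *-vanishʳ (weight N i)
                           (Cℤ-too-large (N ∸ i) k i (subst (_< k) (sym (ℕP.m∸n+n≡m (i<1+n⇒i≤n i≤N))) N<k))))
                         (sym (closed-vanishes N k 1≤N N<k))
  ... | inj₁ k≤N = begin
      lowSum N (+ k)
    ≡⟨ ∑-extend (suc k) (suc N) (s≤s k≤N) (λ i k<i → *-vanishʳ (weight N i) (Cℤ-negative (N ∸ i) k i k<i)) ⟩
      ∑ (suc k) (λ i → weight N i * Cℤ (N ∸ i) (+ k - + i))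
    ≡⟨ ∑-cong (suc k) (λ i i≤k → lowSum-term N k i (i<1+n⇒i≤n i≤k) k≤N) ⟩
      ∑ (suc k) (λ i → X * (mset N i * mset (N ℕ.+ N ∸ k) (k ∸ i)))
    ≡⟨ ∑-*ˡ (suc k) X _ ⟩
      X * (mset N ⋆ mset (N ℕ.+ N ∸ k)) k
    ≡⟨ cong (X *_) (upper-vandermonde N (N ℕ.+ N ∸ k) k) ⟩
      X * mset (suc (N ℕ.+ (N ℕ.+ N ∸ k))) k
    ≡⟨ cong (λ z → X * + bin z k) top ⟩
      X * + bin (suc (N ℕ.+ N ℕ.+ N)) k
    ≡⟨ sym (ℤP.pos-* (bin (N ℕ.+ N ∸ k) N) _) ⟩
      closed N k ∎
    where
    X = + bin (N ℕ.+ N ∸ k) N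
    top : suc (N ℕ.+ (N ℕ.+ N ∸ k)) ℕ.+ k ≡ suc (N ℕ.+ N ℕ.+ N)
    top = cong suc (trans (ℕP.+-assoc N (N ℕ.+ N ∸ k) k)
            (trans (cong (N ℕ.+_) (ℕP.m∸n+n≡m (ℕP.≤-trans k≤N (ℕP.m≤m+n N N)))) (ℕP.+-comm N (N ℕ.+ N))))

  trinomial-revisionℤ : ∀ A j c → c ≤ A → + bin A j * Cℤ j (+ c) ≡ + bin A c * Cℤ (A ∸ c) (+ j - + c)
  trinomial-revisionℤ A j c c≤A with ℕP.≤-<-connex c j
  ... | inj₂ j<c = trans (*-vanishʳ (+ bin A j) (Cℤ-above j c j<c)) (sym (*-vanishʳ (+ bin A c) (Cℤ-negative _ j c j<c)))
  ... | inj₁ c≤j = begin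
      + bin A j * + bin j c                       ≡⟨ sym (ℤP.pos-* (bin A j) (bin j c)) ⟩
      + (bin A j ℕ.* bin j c)                     ≡⟨ cong +_ (trinomial-revision A j c c≤j) ⟩
      + (bin A c ℕ.* bin (A ∸ c) (j ∸ c))         ≡⟨ ℤP.pos-* (bin A c) _ ⟩
      + bin A c * Cℤ (A ∸ c) (+ (j ∸ c))          ≡⟨ cong (λ z → + bin A c * Cℤ (A ∸ c) z) (pos-∸ j c c≤j) ⟩
      + bin A c * Cℤ (A ∸ c) (+ j - + c)          ∎

  revision-at-N : ∀ N j b → Cℤ b (+ N - + j) * Cℤ (suc (N ℕ.+ N)) (+ b)
                          ≡ Cℤ (suc (N ℕ.+ N)) (+ N - + j) * Cℤ (N ℕ.+ suc j) (+ b - + N + + j)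
  revision-at-N N j b with ℕP.≤-<-connex j N
  ... | inj₂ N<j rewrite Cℤ-negative b N j N<j | Cℤ-negative (suc (N ℕ.+ N)) N j N<j = refl
  ... | inj₁ j≤N with ℕP.m≤n⇒∃[o]m+o≡n j≤N
  ...   | c , refl = begin
      Cℤ b (+ (j ℕ.+ c) - + j) * + bin M b
    ≡⟨ trans (cong (λ z → Cℤ b z * + bin M b) N-j) (ℤP.*-comm (Cℤ b (+ c)) (+ bin M b)) ⟩
      + bin M b * Cℤ b (+ c)
    ≡⟨ trinomial-revisionℤ M b c c≤M ⟩
      + bin M c * Cℤ (M ∸ c) (+ b - + c)
    ≡⟨ cong₂ (λ x y → x * Cℤ (M ∸ c) y) (cong (Cℤ M) (sym N-j)) (index (+ b) (+ j) (+ c)) ⟩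
      Cℤ M (+ (j ℕ.+ c) - + j) * Cℤ (M ∸ c) (+ b - (+ j + + c) + + j)
    ≡⟨ cong₂ (λ x y → Cℤ M (+ (j ℕ.+ c) - + j) * Cℤ x (+ b - y + + j)) M-c (sym (ℤP.pos-+ j c)) ⟩
      Cℤ M (+ (j ℕ.+ c) - + j) * Cℤ (j ℕ.+ c ℕ.+ suc j) (+ b - + (j ℕ.+ c) + + j) ∎
    where
    M = suc (j ℕ.+ c ℕ.+ (j ℕ.+ c))
    c≤M : c ≤ M
    c≤M = ℕP.≤-trans (ℕP.m≤n+m c j) (ℕP.≤-trans (ℕP.m≤m+n (j ℕ.+ c) (j ℕ.+ c)) (ℕP.n≤1+n _))
    N-j : + (j ℕ.+ c) - + j ≡ + c
    N-j = trans (sym (pos-∸ (j ℕ.+ c) j (ℕP.m≤m+n j c))) (cong +_ (ℕP.m+n∸m≡n j c))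
    index : ∀ b j c → b - c ≡ b - (j + c) + j
    index = solve-∀
    M-c : M ∸ c ≡ j ℕ.+ c ℕ.+ suc j
    M-c = trans (cong (_∸ c) (regroup j c)) (ℕP.m+n∸m≡n c (j ℕ.+ c ℕ.+ suc j))
      where
      regroup : ∀ j c → suc (j ℕ.+ c ℕ.+ (j ℕ.+ c)) ≡ c ℕ.+ (j ℕ.+ c ℕ.+ suc j)
      regroup = ℕSolver.solve-∀

  vandermonde-padded : ∀ A b N L → A ≤ L → ∑ (suc L) (λ j → Cℤ A (+ j) * Cℤ b (+ N - + j)) ≡ Cℤ (A ℕ.+ b) (+ N)
  vandermonde-padded A b N L A≤L =
    trans (∑-extend (suc A) (suc L) (s≤s A≤L) (λ j A<j → *-vanishˡ (Cℤ b (+ N - + j)) (Cℤ-above A j A<j)))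
          (vandermonde A b (+ N))

  -- The term of the alternating sum after expanding C(2N-i, N) by Vandermonde as
  -- Σ_j C(2N-k, j) C(k-i, N-j) and revising C(k-i, N-j) C(2N+1, k-i):
  --   (-1)^i C(N+i, i) · C(2N-k, j) · C(2N+1, N-j) · C(N+1+j, k-N+j-i).
  expanded : ℕ → ℕ → ℕ → ℕ → ℤ
  expanded N k i j = (sign i * mset N i) * (Cℤ (N ℕ.+ N ∸ k) (+ j) *
    (Cℤ (suc (N ℕ.+ N)) (+ N - + j) * Cℤ (N ℕ.+ suc j) ((+ k - + N + + j) - + i)))

  -- For i > k every expanded term vanishes: either N-j < 0 or k-N+j-i < 0.
  expanded-vanishes : ∀ N k i j → k < i → expanded N k i j ≡ 0ℤ
  expanded-vanishes N k i j k<i = *-vanishʳ (sign i * mset N i) (*-vanishʳ (Cℤ (N ℕ.+ N ∸ k) (+ j)) last-factors)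
    where
    index : ∀ k N j i → (k - N + j) - i ≡ (k + j) - (N + i)
    index = solve-∀
    last-factors : Cℤ (suc (N ℕ.+ N)) (+ N - + j) * Cℤ (N ℕ.+ suc j) ((+ k - + N + + j) - + i) ≡ 0ℤ
    last-factors with ℕP.≤-<-connex j N
    ... | inj₂ N<j = *-vanishˡ _ (Cℤ-negative _ N j N<j)
    ... | inj₁ j≤N = *-vanishʳ (Cℤ (suc (N ℕ.+ N)) (+ N - + j))
          (trans (cong (Cℤ (N ℕ.+ suc j)) (trans (index (+ k) (+ N) (+ j) (+ i)) (sym (cong₂ _-_ (ℤP.pos-+ k j) (ℤP.pos-+ N i)))))
                 (Cℤ-negative _ (k ℕ.+ j) (N ℕ.+ i) (subst (k ℕ.+ j <_) (ℕP.+-comm i N) (ℕP.+-mono-<-≤ k<i j≤N))))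

  revision-shifted : ∀ N i b j → Cℤ b (+ N - + j) * Cℤ (suc (N ℕ.+ N)) (+ b)
    ≡ Cℤ (suc (N ℕ.+ N)) (+ N - + j) * Cℤ (N ℕ.+ suc j) ((+ (i ℕ.+ b) - + N + + j) - + i)
  revision-shifted N i b j = trans (revision-at-N N j b)
    (cong (λ z → Cℤ (suc (N ℕ.+ N)) (+ N - + j) * Cℤ (N ℕ.+ suc j) z)
          (trans (index (+ b) (+ N) (+ j) (+ i)) (cong (λ z → (z - + N + + j) - + i) (sym (ℤP.pos-+ i b)))))
    where
    index : ∀ b N j i → b - N + j ≡ ((i + b) - N + j) - i
    index = solve-∀

  expand-term : ∀ N k i → k ≤ N ℕ.+ N →
    (sign i * weight N i) * Cℤ (suc (N ℕ.+ N)) (+ k - + i) ≡ ∑ (suc (N ℕ.+ N)) (expanded N k i)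
  expand-term N k i k≤2N with ℕP.≤-<-connex i k
  ... | inj₂ k<i = trans (*-vanishʳ (sign i * weight N i) (Cℤ-negative _ k i k<i))
                         (sym (∑-zero (suc (N ℕ.+ N)) (λ j _ → expanded-vanishes N k i j k<i)))
  ... | inj₁ i≤k with ℕP.m≤n⇒∃[o]m+o≡n i≤k
  ...   | b , refl = begin
      (sign i * (mset N i * + bin (N ℕ.+ N ∸ i) N)) * Cℤ M (+ (i ℕ.+ b) - + i)
    ≡⟨ cong₂ (λ x y → (sign i * (mset N i * x)) * Cℤ M y) (sym split) k-i ⟩
      (sign i * (mset N i * S)) * Cℤ M (+ b)
    ≡⟨ regroup (sign i) (mset N i) S (Cℤ M (+ b)) ⟩
      (sign i * mset N i) * (S * Cℤ M (+ b))
    ≡⟨ cong ((sign i * mset N i) *_) (∑-*ʳ (suc (N ℕ.+ N)) _ (Cℤ M (+ b))) ⟩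
      (sign i * mset N i) * ∑ (suc (N ℕ.+ N)) (λ j → (Cℤ A (+ j) * Cℤ b (+ N - + j)) * Cℤ M (+ b))
    ≡⟨ sym (∑-*ˡ (suc (N ℕ.+ N)) (sign i * mset N i) _) ⟩
      ∑ (suc (N ℕ.+ N)) (λ j → (sign i * mset N i) * ((Cℤ A (+ j) * Cℤ b (+ N - + j)) * Cℤ M (+ b)))
    ≡⟨ ∑-cong (suc (N ℕ.+ N)) (λ j _ → cong ((sign i * mset N i) *_)
         (trans (ℤP.*-assoc (Cℤ A (+ j)) (Cℤ b (+ N - + j)) (Cℤ M (+ b)))
                (cong (Cℤ A (+ j) *_) (revision-shifted N i b j)))) ⟩
      ∑ (suc (N ℕ.+ N)) (expanded N (i ℕ.+ b) i) ∎
    where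
    M = suc (N ℕ.+ N)
    A = N ℕ.+ N ∸ (i ℕ.+ b)
    S = ∑ (suc (N ℕ.+ N)) (λ j → Cℤ A (+ j) * Cℤ b (+ N - + j))
    -- 2N - i = (2N - k) + (k - i)
    split : S ≡ + bin (N ℕ.+ N ∸ i) N
    split = trans (vandermonde-padded A b N (N ℕ.+ N) (ℕP.m∸n≤m (N ℕ.+ N) (i ℕ.+ b)))
                  (cong (λ z → + bin z N) (trans (cong (ℕ._+ b) (sym (ℕP.∸-+-assoc (N ℕ.+ N) i b)))
                     (ℕP.m∸n+n≡m (ℕP.m+n≤o⇒m≤o∸n b (subst (_≤ N ℕ.+ N) (ℕP.+-comm i b) k≤2N)))))
    k-i : + (i ℕ.+ b) - + i ≡ + b
    k-i = trans (sym (pos-∸ (i ℕ.+ b) i (ℕP.m≤m+n i b))) (cong +_ (ℕP.m+n∸m≡n i b))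
    regroup : ∀ s m B Z → (s * (m * B)) * Z ≡ (s * m) * (B * Z)
    regroup = solve-∀

  -- Summing over i with the inverse relation:
  --   Σ_{i ≤ 3N} expanded N k i j = C(2N-k, j) C(2N+1, N-j) C(j, k-N+j).
  sum-over-i : ∀ N k j → k ≤ N ℕ.+ N →
    ∑ (suc (N ℕ.+ N ℕ.+ N)) (λ i → expanded N k i j)
      ≡ (Cℤ (N ℕ.+ N ∸ k) (+ j) * Cℤ (suc (N ℕ.+ N)) (+ N - + j)) * Cℤ j (+ k - + N + + j)
  sum-over-i N k j k≤2N = begin
      ∑ R (λ i → expanded N k i j)
    ≡⟨ ∑-cong R (λ i _ → regroup (sign i) (mset N i) (Cℤ (N ℕ.+ N ∸ k) (+ j)) (Cℤ (suc (N ℕ.+ N)) (+ N - + j))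
                                 (Cℤ (N ℕ.+ suc j) (r - + i))) ⟩
      ∑ R (λ i → Y * (alt N i * Cℤ (N ℕ.+ suc j) (r - + i)))
    ≡⟨ ∑-*ˡ R Y _ ⟩
      Y * ∑ R (λ i → alt N i * Cℤ (N ℕ.+ suc j) (r - + i))
    ≡⟨ invert ⟩
      Y * Cℤ j r ∎
    where
    R = suc (N ℕ.+ N ℕ.+ N)
    r = + k - + N + + j
    Y = Cℤ (N ℕ.+ N ∸ k) (+ j) * Cℤ (suc (N ℕ.+ N)) (+ N - + j)
    regroup : ∀ s m B C Z → (s * m) * (B * (C * Z)) ≡ (B * C) * ((s * m) * Z)
    regroup = solve-∀
    invert : Y * ∑ R (λ i → alt N i * Cℤ (N ℕ.+ suc j) (r - + i)) ≡ Y * Cℤ j r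
    invert with ℕP.≤-<-connex j N
    ... | inj₂ N<j = trans (*-vanishˡ _ Y≡0) (sym (*-vanishˡ _ Y≡0))
      where
      Y≡0 : Y ≡ 0ℤ
      Y≡0 = *-vanishʳ (Cℤ (N ℕ.+ N ∸ k) (+ j)) (Cℤ-negative _ N j N<j)
    ... | inj₁ j≤N = cong (Y *_) (inverse-relation N j R r truncation)
      where
      index : ∀ k N j R → (k - N + j) - R ≡ (k + j) - (N + R)
      index = solve-∀
      k+j<N+R : k ℕ.+ j < N ℕ.+ R
      k+j<N+R = subst (k ℕ.+ j <_) (ℕP.+-comm R N) (ℕP.≤-trans (s≤s (ℕP.+-mono-≤ k≤2N j≤N)) (ℕP.m≤m+n R N))
      truncation : ∀ n → Cℤ n (r - + R) ≡ 0ℤ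
      truncation n = trans (cong (Cℤ n) (trans (index (+ k) (+ N) (+ j) (+ R)) (sym (cong₂ _-_ (ℤP.pos-+ k j) (ℤP.pos-+ N R)))))
                           (Cℤ-negative n _ _ k+j<N+R)

  vandermonde-reflected : ∀ M k c → k ℕ.+ c ≤ M →
    ∑ (suc (k ℕ.+ c)) (λ j → Cℤ M (+ (k ℕ.+ c) - + j) * Cℤ (k ℕ.+ c) (+ j - + c)) ≡ Cℤ (M ℕ.+ (k ℕ.+ c)) (+ k)
  vandermonde-reflected M k c N≤M = begin
      ∑ (suc N) h
    ≡⟨ ∑-reverse (suc N) h ⟩
      ∑ (suc N) (λ j → h (N ∸ j))
    ≡⟨ ∑-cong (suc N) (λ j j≤N → reflect j (i<1+n⇒i≤n j≤N)) ⟩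
      ∑ (suc N) (λ j → Cℤ M (+ j) * Cℤ N (+ k - + j))
    ≡⟨ sym (∑-extend (suc N) (suc M) (s≤s N≤M)
             (λ j N<j → *-vanishʳ (Cℤ M (+ j)) (Cℤ-negative N k j (ℕP.≤-trans (s≤s (ℕP.m≤m+n k c)) N<j)))) ⟩
      ∑ (suc M) (λ j → Cℤ M (+ j) * Cℤ N (+ k - + j))
    ≡⟨ vandermonde M N (+ k) ⟩
      Cℤ (M ℕ.+ N) (+ k) ∎
    where
    N = k ℕ.+ c
    h : ℕ → ℤ
    h j = Cℤ M (+ N - + j) * Cℤ N (+ j - + c)
    cancel : ∀ n j → n - (n - j) ≡ j
    cancel = solve-∀
    shift-c : ∀ k c j → (k + c) - j - c ≡ k - j
    shift-c = solve-∀
    reflect : ∀ j → j ≤ N → h (N ∸ j) ≡ Cℤ M (+ j) * Cℤ N (+ k - + j)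
    reflect j j≤N rewrite pos-∸ N j j≤N | ℤP.pos-+ k c =
      cong₂ (λ x y → Cℤ M x * Cℤ (k ℕ.+ c) y) (cancel (+ k + + c) (+ j)) (shift-c (+ k) (+ c) (+ j))

  2N-k≡c+N : ∀ k c → let N = k ℕ.+ c in N ℕ.+ N ∸ k ≡ c ℕ.+ N
  2N-k≡c+N k c = trans (cong (_∸ k) (ℕP.+-assoc k c (k ℕ.+ c))) (ℕP.m+n∸m≡n k (c ℕ.+ (k ℕ.+ c)))

  -- The summand of sum-over-j for N = k + c: by C(j, k-N+j) = C(j, c) and trinomial revision,
  --   C(2N-k, j) C(2N+1, N-j) C(j, k-N+j) = C(c+N, c) · C(2N+1, N-j) C(N, j-c).
  sum-over-j-term : ∀ k c j → let N = k ℕ.+ c ; M = suc (N ℕ.+ N) in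
    (Cℤ (N ℕ.+ N ∸ k) (+ j) * Cℤ M (+ N - + j)) * Cℤ j (+ k - + N + + j)
      ≡ + bin (c ℕ.+ N) c * (Cℤ M (+ N - + j) * Cℤ N (+ j - + c))
  sum-over-j-term k c j = begin
      (Cℤ (N ℕ.+ N ∸ k) (+ j) * Cℤ M (+ N - + j)) * Cℤ j (+ k - + N + + j)
    ≡⟨ cong₂ (λ x y → (Cℤ x (+ j) * Cℤ M (+ N - + j)) * y) (2N-k≡c+N k c)
             (trans (Cℤ-reflect j _) (cong (Cℤ j) (trans (cong (λ z → + j - (+ k - z + + j)) (ℤP.pos-+ k c))
                                                         (index (+ k) (+ c) (+ j))))) ⟩
      (Cℤ (c ℕ.+ N) (+ j) * Cℤ M (+ N - + j)) * Cℤ j (+ c)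
    ≡⟨ trans (ℤP.*-assoc (Cℤ (c ℕ.+ N) (+ j)) (Cℤ M (+ N - + j)) (Cℤ j (+ c))) (swap (Cℤ (c ℕ.+ N) (+ j)) (Cℤ M (+ N - + j)) (Cℤ j (+ c))) ⟩
      Cℤ M (+ N - + j) * (Cℤ (c ℕ.+ N) (+ j) * Cℤ j (+ c))
    ≡⟨ cong (Cℤ M (+ N - + j) *_) (trinomial-revisionℤ (c ℕ.+ N) j c (ℕP.m≤m+n c N)) ⟩
      Cℤ M (+ N - + j) * (+ bin (c ℕ.+ N) c * Cℤ (c ℕ.+ N ∸ c) (+ j - + c))
    ≡⟨ cong (λ z → Cℤ M (+ N - + j) * (+ bin (c ℕ.+ N) c * Cℤ z (+ j - + c))) (ℕP.m+n∸m≡n c N) ⟩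
      Cℤ M (+ N - + j) * (+ bin (c ℕ.+ N) c * Cℤ N (+ j - + c))
    ≡⟨ swap (Cℤ M (+ N - + j)) (+ bin (c ℕ.+ N) c) (Cℤ N (+ j - + c)) ⟩
      + bin (c ℕ.+ N) c * (Cℤ M (+ N - + j) * Cℤ N (+ j - + c)) ∎
    where
    N = k ℕ.+ c
    M = suc (N ℕ.+ N)
    index : ∀ k c j → j - (k - (k + c) + j) ≡ c
    index = solve-∀
    swap : ∀ a b d → a * (b * d) ≡ b * (a * d)
    swap = solve-∀

  sum-over-j : ∀ N k → 1 ≤ N → k ≤ N ℕ.+ N →
    ∑ (suc (N ℕ.+ N)) (λ j → (Cℤ (N ℕ.+ N ∸ k) (+ j) * Cℤ (suc (N ℕ.+ N)) (+ N - + j)) * Cℤ j (+ k - + N + + j))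
      ≡ closed N k
  sum-over-j N k 1≤N k≤2N with ℕP.≤-<-connex k N
  ... | inj₂ N<k = trans (∑-zero (suc (N ℕ.+ N)) (λ j _ → *-vanishʳ (Cℤ (N ℕ.+ N ∸ k) (+ j) * Cℤ (suc (N ℕ.+ N)) (+ N - + j))
                                                                (last-vanishes j)))
                         (sym (closed-vanishes N k 1≤N N<k))
    where
    index : ∀ k N j → k - N + j ≡ (k + j) - N
    index = solve-∀
    last-vanishes : ∀ j → Cℤ j (+ k - + N + + j) ≡ 0ℤ
    last-vanishes j = trans (cong (Cℤ j) (trans (index (+ k) (+ N) (+ j)) (cong (_- + N) (sym (ℤP.pos-+ k j)))))
                            (Cℤ-too-large j (k ℕ.+ j) N (subst (_< k ℕ.+ j) (ℕP.+-comm N j) (ℕP.+-monoˡ-< j N<k)))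
  ... | inj₁ k≤N with ℕP.m≤n⇒∃[o]m+o≡n k≤N
  ...   | c , refl = begin
      ∑ (suc (N ℕ.+ N)) (λ j → (Cℤ (N ℕ.+ N ∸ k) (+ j) * Cℤ M (+ N - + j)) * Cℤ j (+ k - + N + + j))
    ≡⟨ ∑-cong (suc (N ℕ.+ N)) (λ j _ → sum-over-j-term k c j) ⟩
      ∑ (suc (N ℕ.+ N)) (λ j → + bin (c ℕ.+ N) c * (Cℤ M (+ N - + j) * Cℤ N (+ j - + c)))
    ≡⟨ ∑-*ˡ (suc (N ℕ.+ N)) (+ bin (c ℕ.+ N) c) _ ⟩
      + bin (c ℕ.+ N) c * ∑ (suc (N ℕ.+ N)) (λ j → Cℤ M (+ N - + j) * Cℤ N (+ j - + c))
    ≡⟨ cong (+ bin (c ℕ.+ N) c *_) (trans (∑-extend (suc N) (suc (N ℕ.+ N)) (s≤s (ℕP.m≤m+n N N))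
                                              (λ j N<j → *-vanishˡ (Cℤ N (+ j - + c)) (Cℤ-negative M N j N<j)))
                                           (vandermonde-reflected M k c (ℕP.≤-trans (ℕP.m≤m+n N N) (ℕP.n≤1+n _)))) ⟩
      + bin (c ℕ.+ N) c * Cℤ (M ℕ.+ N) (+ k)
    ≡⟨ cong (λ x → + x * Cℤ (M ℕ.+ N) (+ k)) (trans (bin-sym+ c N) (cong (λ z → bin z N) (sym (2N-k≡c+N k c)))) ⟩
      + bin (N ℕ.+ N ∸ k) N * + bin (M ℕ.+ N) k
    ≡⟨ sym (ℤP.pos-* (bin (N ℕ.+ N ∸ k) N) _) ⟩
      closed N k ∎
    where
    M = suc (N ℕ.+ N)

  altSum-closed : ∀ N k → 1 ≤ N → k ≤ N ℕ.+ N → altSum N (+ k) ≡ closed N k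
  altSum-closed N k 1≤N k≤2N = begin
      altSum N (+ k)
    ≡⟨ sym (∑-extend (suc N) R (s≤s (ℕP.≤-trans (ℕP.m≤m+n N N) (ℕP.m≤m+n (N ℕ.+ N) N)))
             (λ i N<i → *-vanishˡ (Cℤ (suc (N ℕ.+ N)) (+ k - + i)) (*-vanishʳ (sign i) (weight-vanishes N i 1≤N N<i)))) ⟩
      ∑ R (λ i → (sign i * weight N i) * Cℤ (suc (N ℕ.+ N)) (+ k - + i))
    ≡⟨ ∑-cong R (λ i _ → expand-term N k i k≤2N) ⟩
      ∑ R (λ i → ∑ (suc (N ℕ.+ N)) (expanded N k i))
    ≡⟨ ∑-swap R (suc (N ℕ.+ N)) (expanded N k) ⟩
      ∑ (suc (N ℕ.+ N)) (λ j → ∑ R (λ i → expanded N k i j))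
    ≡⟨ ∑-cong (suc (N ℕ.+ N)) (λ j _ → sum-over-i N k j k≤2N) ⟩
      ∑ (suc (N ℕ.+ N)) (λ j → (Cℤ (N ℕ.+ N ∸ k) (+ j) * Cℤ (suc (N ℕ.+ N)) (+ N - + j)) * Cℤ j (+ k - + N + + j))
    ≡⟨ sum-over-j N k 1≤N k≤2N ⟩
      closed N k ∎
    where
    R = suc (N ℕ.+ N ℕ.+ N)

  -- For even N, altSum is symmetric under q ↦ 3N+1-q (reverse i ↦ N-i; w and (-1)^i are palindromic) ...
  altSum-reflect : ∀ n q → let N = n ℕ.+ n in altSum N q ≡ altSum N (+ suc (N ℕ.+ N ℕ.+ N) - q)
  altSum-reflect n q = begin
      ∑ (suc N) g                     ≡⟨ ∑-reverse (suc N) g ⟩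
      ∑ (suc N) (λ i → g (N ∸ i))     ≡⟨ ∑-cong (suc N) (λ i i≤N → sym (reflect-term i (i<1+n⇒i≤n i≤N))) ⟩
      altSum N (+ Q - q)              ∎
    where
    N = n ℕ.+ n
    M = suc (N ℕ.+ N)
    Q = suc (N ℕ.+ N ℕ.+ N)
    g : ℕ → ℤ
    g i = (sign i * weight N i) * Cℤ M (q - + i)
    index : ∀ N q i → (1ℤ + (N + N)) - ((1ℤ + (N + N + N) - q) - i) ≡ q - (N - i)
    index = solve-∀
    reflect-index : ∀ i → i ≤ N → + M - ((+ Q - q) - + i) ≡ q - + (N ∸ i)
    reflect-index i i≤N rewrite pos-∸ N i i≤N | ℤP.pos-+ (N ℕ.+ N) N | ℤP.pos-+ N N = index (+ n + + n) q (+ i)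
    reflect-term : ∀ i → i ≤ N → (sign i * weight N i) * Cℤ M ((+ Q - q) - + i) ≡ g (N ∸ i)
    reflect-term i i≤N = cong₂ _*_
       (sym (cong₂ _*_ (sign-reflect n i i≤N) (weight-reflect N i i≤N)))
       (trans (Cℤ-reflect M _) (cong (Cℤ M) (reflect-index i i≤N)))

  highSum-reflect : ∀ N q → highSum N q ≡ lowSum N (+ suc (N ℕ.+ N ℕ.+ N) - q)
  highSum-reflect N q = ∑-cong (suc N) (λ i i≤N → cong (weight N i *_)
    (sym (trans (Cℤ-reflect (N ∸ i) _) (cong (Cℤ (N ∸ i)) (reflect-index i (i<1+n⇒i≤n i≤N))))))
    where
    index : ∀ N q i → (N - i) - ((1ℤ + (N + N + N) - q) - i) ≡ q - (1ℤ + (N + N))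
    index = solve-∀
    reflect-index : ∀ i → i ≤ N → + (N ∸ i) - ((+ suc (N ℕ.+ N ℕ.+ N) - q) - + i) ≡ q - + suc (N ℕ.+ N)
    reflect-index i i≤N rewrite pos-∸ N i i≤N | ℤP.pos-+ (N ℕ.+ N) N | ℤP.pos-+ N N = index (+ N) q (+ i)

  sums-negative : ∀ N m → altSum N -[1+ m ] ≡ 0ℤ × lowSum N -[1+ m ] ≡ 0ℤ × highSum N -[1+ m ] ≡ 0ℤ
  sums-negative N m = ∑-zero (suc N) (λ i _ → *-vanishʳ (sign i * weight N i) (Cℤ-negsuc _ m i))
                    , ∑-zero (suc N) (λ i _ → *-vanishʳ (weight N i) (Cℤ-negsuc (N ∸ i) m i))
                    , ∑-zero (suc N) (λ i _ → *-vanishʳ (weight N i) (Cℤ-negsuc (N ∸ i) m (suc (N ℕ.+ N))))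

  -- Below 2N the alternating sum equals lowSum, both being given by the closed form.
  altSum-below : ∀ N q → 1 ≤ N → q ℤ.≤ + (N ℕ.+ N) → altSum N q ≡ lowSum N q
  altSum-below N -[1+ m ] 1≤N _ = trans (proj₁ (sums-negative N m)) (sym (proj₁ (proj₂ (sums-negative N m))))
  altSum-below N (+ k)    1≤N k≤2N = trans (altSum-closed N k 1≤N (ℤP.drop‿+≤+ k≤2N)) (sym (lowSum-closed N k 1≤N))

  reflected-below : ∀ N k → N < k → + suc (N ℕ.+ N ℕ.+ N) - + k ℤ.≤ + (N ℕ.+ N)
  reflected-below N k N<k = ℤP.≤-trans (ℤP.+-monoʳ-≤ (+ suc (N ℕ.+ N ℕ.+ N)) (ℤP.neg-mono-≤ (ℤ.+≤+ N<k)))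
                                       (ℤP.≤-reflexive (trans (sym (pos-∸ _ (suc N) N<Q)) (cong +_ (ℕP.m+n∸n≡m (N ℕ.+ N) N))))
    where
    N<Q : suc N ≤ suc (N ℕ.+ N ℕ.+ N)
    N<Q = s≤s (ℕP.m≤n+m N (N ℕ.+ N))

  core-identity : ∀ n q → 1 ≤ n ℕ.+ n → altSum (n ℕ.+ n) q ≡ lowSum (n ℕ.+ n) q + highSum (n ℕ.+ n) q
  core-identity n -[1+ m ] _ with sums-negative (n ℕ.+ n) m
  ... | alt≡0 , low≡0 , high≡0 rewrite alt≡0 | low≡0 | high≡0 = refl
  core-identity n (+ k) 1≤N with ℕP.≤-<-connex k (n ℕ.+ n ℕ.+ (n ℕ.+ n))
  ... | inj₁ k≤2N = begin
      altSum N (+ k)                    ≡⟨ altSum-below N (+ k) 1≤N (ℤ.+≤+ k≤2N) ⟩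
      lowSum N (+ k)                    ≡⟨ sym (ℤP.+-identityʳ _) ⟩
      lowSum N (+ k) + 0ℤ               ≡⟨ cong (λ z → lowSum N (+ k) + z) (sym high≡0) ⟩
      lowSum N (+ k) + highSum N (+ k)  ∎
    where
    N = n ℕ.+ n
    high≡0 : highSum N (+ k) ≡ 0ℤ
    high≡0 = ∑-zero (suc N) (λ i _ → *-vanishʳ (weight N i) (Cℤ-negative (N ∸ i) k (suc (N ℕ.+ N)) (s≤s k≤2N)))
  ... | inj₂ 2N<k = begin
      altSum N (+ k)                    ≡⟨ altSum-reflect n (+ k) ⟩
      altSum N (+ Q - + k)              ≡⟨ altSum-below N (+ Q - + k) 1≤N (reflected-below N k N<k) ⟩
      lowSum N (+ Q - + k)              ≡⟨ sym (highSum-reflect N (+ k)) ⟩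
      highSum N (+ k)                   ≡⟨ sym (ℤP.+-identityˡ _) ⟩
      0ℤ + highSum N (+ k)              ≡⟨ cong (_+ highSum N (+ k)) (sym low≡0) ⟩
      lowSum N (+ k) + highSum N (+ k)  ∎
    where
    N = n ℕ.+ n
    Q = suc (N ℕ.+ N ℕ.+ N)
    N<k : N < k
    N<k = ℕP.≤-<-trans (ℕP.m≤m+n N N) 2N<k
    low≡0 : lowSum N (+ k) ≡ 0ℤ
    low≡0 = ∑-zero (suc N) (λ i i≤N → *-vanishʳ (weight N i) (Cℤ-too-large (N ∸ i) k i
              (subst (_< k) (sym (ℕP.m∸n+n≡m (i<1+n⇒i≤n i≤N))) N<k)))

  -- Raising top indices by L via Vandermonde, C(L+U, r) = Σ_t C(L, t) C(U, r-t), and swapping sums.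
  lift-sum : ∀ K L (f : ℕ → ℤ) (U : ℕ → ℕ) (g : ℕ → ℤ) q →
    ∑ K (λ i → f i * Cℤ (L ℕ.+ U i) (q - g i))
      ≡ ∑ (suc L) (λ t → Cℤ L (+ t) * ∑ K (λ i → f i * Cℤ (U i) ((q - + t) - g i)))
  lift-sum K L f U g q = begin
      ∑ K (λ i → f i * Cℤ (L ℕ.+ U i) (q - g i))
    ≡⟨ ∑-cong K (λ i _ → cong (f i *_) (sym (vandermonde L (U i) (q - g i)))) ⟩
      ∑ K (λ i → f i * ∑ (suc L) (λ t → Cℤ L (+ t) * Cℤ (U i) ((q - g i) - + t)))
    ≡⟨ ∑-cong K (λ i _ → sym (∑-*ˡ (suc L) (f i) _)) ⟩
      ∑ K (λ i → ∑ (suc L) (λ t → f i * (Cℤ L (+ t) * Cℤ (U i) ((q - g i) - + t))))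
    ≡⟨ ∑-swap K (suc L) _ ⟩
      ∑ (suc L) (λ t → ∑ K (λ i → f i * (Cℤ L (+ t) * Cℤ (U i) ((q - g i) - + t))))
    ≡⟨ ∑-cong (suc L) (λ t _ → trans (∑-cong K (λ i _ → rearrange (f i) (Cℤ L (+ t)) (U i) (g i) (+ t)))
                                     (∑-*ˡ K (Cℤ L (+ t)) _)) ⟩
      ∑ (suc L) (λ t → Cℤ L (+ t) * ∑ K (λ i → f i * Cℤ (U i) ((q - + t) - g i))) ∎
    where
    swap : ∀ a b c → a * (b * c) ≡ b * (a * c)
    swap = solve-∀
    sub-comm : ∀ q g t → (q - g) - t ≡ (q - t) - g
    sub-comm = solve-∀
    rearrange : ∀ a b u x t → a * (b * Cℤ u ((q - x) - t)) ≡ b * (a * Cℤ u ((q - t) - x))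
    rearrange a b u x t = trans (swap a b _) (cong (λ z → b * (a * Cℤ u z)) (sub-comm q x t))

  -- The three-term identity for N = 2(m+1): with L = N - 1, lift the core identity from
  -- top indices 2N+1 and N-i to 3N = L + (2N+1) and 2N-1-i = L + (N-i):
  --   Σ_i (-1)^i w_i C(3N, q-i) = Σ_i w_i C(2N-1-i, q-i) + Σ_i w_i C(2N-1-i, q-2N-1).
  three-term-identity : ∀ m q → let N = suc m ℕ.+ suc m in
    ∑ (suc N) (λ i → (sign i * weight N i) * Cℤ (N ℕ.+ N ℕ.+ N) (q - + i))
    ≡ ∑ (suc N) (λ i → weight N i * Cℤ (N ℕ.+ N ∸ suc i) (q - + i))
      + ∑ (suc N) (λ i → weight N i * Cℤ (N ℕ.+ N ∸ suc i) (q - + suc (N ℕ.+ N)))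
  three-term-identity m q = begin
      ∑ (suc N) (λ i → (sign i * weight N i) * Cℤ (N ℕ.+ N ℕ.+ N) (q - + i))
    ≡⟨ ∑-cong (suc N) (λ i _ → cong (λ z → (sign i * weight N i) * Cℤ z (q - + i)) 3N≡L+2N+1) ⟩
      ∑ (suc N) (λ i → (sign i * weight N i) * Cℤ (L ℕ.+ suc (N ℕ.+ N)) (q - + i))
    ≡⟨ lift-sum (suc N) L (λ i → sign i * weight N i) (λ _ → suc (N ℕ.+ N)) +_ q ⟩
      ∑ (suc L) (λ t → Cℤ L (+ t) * altSum N (q - + t))
    ≡⟨ ∑-cong (suc L) (λ t _ → cong (Cℤ L (+ t) *_) (core-identity (suc m) (q - + t) (s≤s z≤n))) ⟩
      ∑ (suc L) (λ t → Cℤ L (+ t) * (lowSum N (q - + t) + highSum N (q - + t)))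
    ≡⟨ ∑-cong (suc L) (λ t _ → ℤP.*-distribˡ-+ (Cℤ L (+ t)) (lowSum N (q - + t)) (highSum N (q - + t))) ⟩
      ∑ (suc L) (λ t → Cℤ L (+ t) * lowSum N (q - + t) + Cℤ L (+ t) * highSum N (q - + t))
    ≡⟨ ∑-+ (suc L) _ _ ⟩
      ∑ (suc L) (λ t → Cℤ L (+ t) * lowSum N (q - + t)) + ∑ (suc L) (λ t → Cℤ L (+ t) * highSum N (q - + t))
    ≡⟨ cong₂ _+_ (sym (lowered (λ i → + i))) (sym (lowered (λ _ → + suc (N ℕ.+ N)))) ⟩
      ∑ (suc N) (λ i → weight N i * Cℤ (N ℕ.+ N ∸ suc i) (q - + i))
      + ∑ (suc N) (λ i → weight N i * Cℤ (N ℕ.+ N ∸ suc i) (q - + suc (N ℕ.+ N))) ∎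
    where
    N = suc m ℕ.+ suc m
    L = m ℕ.+ suc m
    3N≡L+2N+1 : N ℕ.+ N ℕ.+ N ≡ L ℕ.+ suc (N ℕ.+ N)
    3N≡L+2N+1 = regroup m
      where
      regroup : ∀ m → suc m ℕ.+ suc m ℕ.+ (suc m ℕ.+ suc m) ℕ.+ (suc m ℕ.+ suc m)
                    ≡ m ℕ.+ suc m ℕ.+ suc (suc m ℕ.+ suc m ℕ.+ (suc m ℕ.+ suc m))
      regroup = ℕSolver.solve-∀
    lowered : ∀ g → ∑ (suc N) (λ i → weight N i * Cℤ (N ℕ.+ N ∸ suc i) (q - g i))
                    ≡ ∑ (suc L) (λ t → Cℤ L (+ t) * ∑ (suc N) (λ i → weight N i * Cℤ (N ∸ i) ((q - + t) - g i)))
    lowered g = trans (∑-cong (suc N) (λ i i≤N → cong (λ z → weight N i * Cℤ z (q - g i))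
                                                    (ℕP.+-∸-assoc L (i<1+n⇒i≤n i≤N))))
                      (lift-sum (suc N) L (weight N) (λ i → N ∸ i) g q)

  even-odd-split : ∀ n (g : ℕ → ℤ) →
    ∑ (suc (n ℕ.+ n)) g ≡ ∑ (suc (n ℕ.+ n)) (λ i → sign i * g i) + ∑ n (λ k → + 2 * g (suc (k ℕ.+ k)))
  even-odd-split zero    g = base (g 0)
    where
    base : ∀ x → 0ℤ + x ≡ (0ℤ + 1ℤ * x) + 0ℤ
    base = solve-∀
  even-odd-split (suc n) g rewrite ℕP.+-suc n n =
    trans (cong (λ z → z + x + y) (even-odd-split n g))
      (trans (step A B x y) (cong (λ s → (A + - s * x + - - s * y) + (B + + 2 * x)) (sym (sign-even n))))
    where
    A = ∑ (suc (n ℕ.+ n)) (λ i → sign i * g i)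
    B = ∑ n (λ k → + 2 * g (suc (k ℕ.+ k)))
    x = g (suc (n ℕ.+ n))
    y = g (suc (suc (n ℕ.+ n)))
    step : ∀ A B x y → A + B + x + y ≡ (A + - 1ℤ * x + - - 1ℤ * y) + (B + + 2 * x)
    step = solve-∀

  reflect-top : ∀ a d i → d ℕ.+ i ≡ a → a ℕ.+ a ∸ suc d ≡ a ℕ.+ i ∸ 1
  reflect-top a d i d+i≡a = trans (cong (a ℕ.+ a ∸_) (ℕP.+-comm 1 d))
    (trans (sym (ℕP.∸-+-assoc (a ℕ.+ a) d 1)) (cong (_∸ 1) (double-∸ a d i d+i≡a)))

-- The integer form of the theorem, for n = p+1, N = 2n and a fixed m; the three binomials of the
-- theorem at j = i+1 are B₁ i, B₂ i and B₃ i.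

module IntegerForm (p m : ℕ) where
  open import Data.Nat using (suc)
  open import Data.Integer using (ℤ; _+_; _*_; _-_; 1ℤ)
  open ≡-Reasoning

  n = suc p
  N = n ℕ.+ n
  A = zsub m (4 ℕ.* n)
  q = A + + suc N

  B₁ B₂ B₃ : ℕ → ℤ
  B₁ i = Cℤ (6 ℕ.* n) (A + + suc i)
  B₂ i = Cℤ (2 ℕ.* n ℕ.+ suc i ∸ 2) (A + + suc i)
  B₃ i = Cℤ (4 ℕ.* n ∸ suc i) (zsub m (6 ℕ.* n))

  twice : ∀ n → 2 ℕ.* n ≡ n ℕ.+ n
  twice = ℕSolver.solve-∀
  four-times : ∀ n → 4 ℕ.* n ≡ (n ℕ.+ n) ℕ.+ (n ℕ.+ n)
  four-times = ℕSolver.solve-∀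
  six-times : ∀ n → 6 ℕ.* n ≡ (n ℕ.+ n) ℕ.+ (n ℕ.+ n) ℕ.+ (n ℕ.+ n)
  six-times = ℕSolver.solve-∀

  reflect-index : ∀ i → i ≤ N → A + + suc N - + (N ∸ i) ≡ A + + suc i
  reflect-index i i≤N rewrite pos-∸ N i i≤N = regroup A (+ N) (+ i)
    where
    regroup : ∀ A N i → A + (1ℤ + N) - (N - i) ≡ A + (1ℤ + i)
    regroup = solve-∀

  -- Reversing i ↦ N-i turns the three sums Σ w_i B_k(i) into those of the three-term identity.
  reversed₁ : ∑ (suc N) (λ i → sign i * (weight N i * B₁ i))
              ≡ ∑ (suc N) (λ i → (sign i * weight N i) * Cℤ (N ℕ.+ N ℕ.+ N) (q - + i))
  reversed₁ = sym (trans (∑-reverse (suc N) _) (∑-cong (suc N) (λ i i≤N → term i (i<1+n⇒i≤n i≤N))))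
    where
    term : ∀ i → i ≤ N → (sign (N ∸ i) * weight N (N ∸ i)) * Cℤ (N ℕ.+ N ℕ.+ N) (q - + (N ∸ i)) ≡ sign i * (weight N i * B₁ i)
    term i i≤N rewrite sign-reflect n i i≤N | weight-reflect N i i≤N | reflect-index i i≤N | six-times n =
      ℤP.*-assoc (sign i) (weight N i) _

  reversed₂ : ∑ (suc N) (λ i → weight N i * B₂ i) ≡ ∑ (suc N) (λ i → weight N i * Cℤ (N ℕ.+ N ∸ suc i) (q - + i))
  reversed₂ = sym (trans (∑-reverse (suc N) _) (∑-cong (suc N) (λ i i≤N → term i (i<1+n⇒i≤n i≤N))))
    where
    top : ∀ i → i ≤ N → N ℕ.+ N ∸ suc (N ∸ i) ≡ 2 ℕ.* n ℕ.+ suc i ∸ 2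
    top i i≤N = trans (reflect-top N (N ∸ i) i (ℕP.m∸n+n≡m i≤N))
                      (sym (trans (cong (λ x → x ℕ.+ suc i ∸ 2) (twice n)) (cong (_∸ 2) (ℕP.+-suc N i))))
    term : ∀ i → i ≤ N → weight N (N ∸ i) * Cℤ (N ℕ.+ N ∸ suc (N ∸ i)) (q - + (N ∸ i)) ≡ weight N i * B₂ i
    term i i≤N rewrite weight-reflect N i i≤N | reflect-index i i≤N | top i i≤N = refl

  reversed₃ : ∑ (suc N) (λ i → weight N i * B₃ i)
              ≡ ∑ (suc N) (λ i → weight N i * Cℤ (N ℕ.+ N ∸ suc i) (q - + suc (N ℕ.+ N)))
  reversed₃ = ∑-cong (suc N) (λ i _ → cong₂ (λ x y → weight N i * Cℤ (x ∸ suc i) y) (four-times n) index)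
    where
    regroup : ∀ m N → m - (N + N + N) ≡ (m - (N + N)) + (1ℤ + N) - (1ℤ + (N + N))
    regroup = solve-∀
    index : zsub m (6 ℕ.* n) ≡ q - + suc (N ℕ.+ N)
    index = begin
        + m - + (6 ℕ.* n)
      ≡⟨ cong (λ z → + m - + z) (six-times n) ⟩
        + m - + (N ℕ.+ N ℕ.+ N)
      ≡⟨ cong (λ z → + m - z) (trans (ℤP.pos-+ (N ℕ.+ N) N) (cong (_+ + N) (ℤP.pos-+ N N))) ⟩
        + m - (+ N + + N + + N)
      ≡⟨ regroup (+ m) (+ N) ⟩
        (+ m - (+ N + + N)) + (1ℤ + + N) - (1ℤ + (+ N + + N))
      ≡⟨ cong (λ z → (+ m - z) + (1ℤ + + N) - (1ℤ + z)) (sym (ℤP.pos-+ N N)) ⟩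
        (+ m - + (N ℕ.+ N)) + + suc N - + suc (N ℕ.+ N)
      ≡⟨ cong (λ z → (+ m - + z) + + suc N - + suc (N ℕ.+ N)) (sym (four-times n)) ⟩
        q - + suc (N ℕ.+ N) ∎

  -- Σ_{i ≤ N} w_i (B₁ - B₂ - B₃)(i) = Σ_{k < n} 2 w_{2k+1} B₁(2k+1): by the even–odd split the claim
  -- is Σ (-1)^i w_i B₁ = Σ w_i B₂ + Σ w_i B₃, which is the reversed three-term identity.
  integer-identity : ∑ (suc N) (λ i → weight N i * (B₁ i - B₂ i - B₃ i))
                     ≡ ∑ n (λ k → (+ 2 * weight N (suc (k ℕ.+ k))) * B₁ (suc (k ℕ.+ k)))
  integer-identity = begin
      ∑ (suc N) (λ i → weight N i * (B₁ i - B₂ i - B₃ i))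
    ≡⟨ ∑-cong (suc N) (λ i _ → distrib (weight N i) (B₁ i) (B₂ i) (B₃ i)) ⟩
      ∑ (suc N) (λ i → (g₁ i - g₂ i) - g₃ i)
    ≡⟨ trans (∑-- (suc N) (λ i → g₁ i - g₂ i) g₃) (cong (_- ∑ (suc N) g₃) (∑-- (suc N) g₁ g₂)) ⟩
      (∑ (suc N) g₁ - ∑ (suc N) g₂) - ∑ (suc N) g₃
    ≡⟨ cong (λ z → (z - ∑ (suc N) g₂) - ∑ (suc N) g₃) (even-odd-split n g₁) ⟩
      ((∑ (suc N) (λ i → sign i * g₁ i) + odd) - ∑ (suc N) g₂) - ∑ (suc N) g₃
    ≡⟨ cong (λ z → ((z + odd) - ∑ (suc N) g₂) - ∑ (suc N) g₃) alternating ⟩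
      ((∑ (suc N) g₂ + ∑ (suc N) g₃ + odd) - ∑ (suc N) g₂) - ∑ (suc N) g₃
    ≡⟨ cancel (∑ (suc N) g₂) (∑ (suc N) g₃) odd ⟩
      odd
    ≡⟨ ∑-cong n (λ k _ → sym (ℤP.*-assoc (+ 2) (weight N (suc (k ℕ.+ k))) (B₁ (suc (k ℕ.+ k))))) ⟩
      ∑ n (λ k → (+ 2 * weight N (suc (k ℕ.+ k))) * B₁ (suc (k ℕ.+ k))) ∎
    where
    g₁ g₂ g₃ : ℕ → ℤ
    g₁ i = weight N i * B₁ i
    g₂ i = weight N i * B₂ i
    g₃ i = weight N i * B₃ i
    odd = ∑ n (λ k → + 2 * g₁ (suc (k ℕ.+ k)))
    distrib : ∀ w a b c → w * (a - b - c) ≡ (w * a - w * b) - w * c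
    distrib = solve-∀
    cancel : ∀ a b x → ((a + b + x) - a) - b ≡ x
    cancel = solve-∀
    alternating : ∑ (suc N) (λ i → sign i * g₁ i) ≡ ∑ (suc N) g₂ + ∑ (suc N) g₃
    alternating = trans reversed₁ (trans (three-term-identity p q) (sym (cong₂ _+_ reversed₂ reversed₃)))

-- From integers to rationals.

module _ where
  open import Data.Nat using (zero; suc; _<_; _!; z≤n; s≤s)
  open import Data.Integer using (ℤ; -[1+_]; _+_; _*_; -_; _-_)
  open import Data.Rational using (ℚ; _/_; toℚᵘ)
  open import Data.Rational.Unnormalised using (mkℚᵘ; *≡*) renaming (_≃_ to _≃ᵘ_)
  import Data.Rational.Unnormalised.Properties as ℚᵘP
  open ≡-Reasoning

  ι : ℤ → ℚ
  ι z = z / 1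

  toℚᵘ-/ : ∀ z d → toℚᵘ (z / suc d) ≃ᵘ mkℚᵘ z d
  toℚᵘ-/ z d = ℚP.toℚᵘ-fromℚᵘ (mkℚᵘ z d)

  ι-+ : ∀ a b → ι (a + b) ≡ ι a ℚ.+ ι b
  ι-+ a b = ℚP.toℚᵘ-injective (ℚᵘP.≃-trans (toℚᵘ-/ (a + b) 0)
    (ℚᵘP.≃-trans (*≡* (unit a b)) (ℚᵘP.≃-sym (ℚᵘP.≃-trans (ℚP.toℚᵘ-homo-+ (ι a) (ι b))
                                                         (ℚᵘP.+-cong (toℚᵘ-/ a 0) (toℚᵘ-/ b 0))))))
    where
    unit : ∀ a b → (a + b) * + 1 ≡ (a * + 1 + b * + 1) * + 1
    unit = solve-∀

  ι-* : ∀ a b → ι (a * b) ≡ ι a ℚ.* ι b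
  ι-* a b = ℚP.toℚᵘ-injective (ℚᵘP.≃-trans (toℚᵘ-/ (a * b) 0)
    (ℚᵘP.≃-sym (ℚᵘP.≃-trans (ℚP.toℚᵘ-homo-* (ι a) (ι b)) (ℚᵘP.*-cong (toℚᵘ-/ a 0) (toℚᵘ-/ b 0)))))

  ι-neg : ∀ a → ι (- a) ≡ ℚ.- ι a
  ι-neg a = ℚP.toℚᵘ-injective (ℚᵘP.≃-trans (toℚᵘ-/ (- a) 0)
    (ℚᵘP.≃-sym (ℚᵘP.≃-trans (ℚP.toℚᵘ-homo‿- (ι a)) (ℚᵘP.-‿cong (toℚᵘ-/ a 0)))))

  ι-- : ∀ a b → ι (a - b) ≡ ι a ℚ.- ι b
  ι-- a b = trans (ι-+ a (- b)) (cong (ι a ℚ.+_) (ι-neg b))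

  frac-product : ∀ P D Q E W → 0 < D → 0 < E → P ℕ.* E ≡ Q ℕ.* W ℕ.* D → frac P D ≡ frac Q E ℚ.* ι (+ W)
  frac-product P (suc d) Q (suc e) W _ _ eq = ℚP.toℚᵘ-injective (ℚᵘP.≃-trans (toℚᵘ-/ (+ P) d)
    (ℚᵘP.≃-trans (*≡* cross) (ℚᵘP.≃-sym (ℚᵘP.≃-trans (ℚP.toℚᵘ-homo-* (frac Q (suc e)) (ι (+ W)))
                                                     (ℚᵘP.*-cong (toℚᵘ-/ (+ Q) e) (toℚᵘ-/ (+ W) 0))))))
    where
    cross : + P * + suc (e ℕ.* 1) ≡ (+ Q * + W) * + suc d
    cross = begin
        + P * + suc (e ℕ.* 1)       ≡⟨ cong (λ z → + P * + suc z) (ℕP.*-identityʳ e) ⟩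
        + P * + suc e               ≡⟨ sym (ℤP.pos-* P (suc e)) ⟩
        + (P ℕ.* suc e)             ≡⟨ cong +_ eq ⟩
        + (Q ℕ.* W ℕ.* suc d)       ≡⟨ ℤP.pos-* (Q ℕ.* W) (suc d) ⟩
        + (Q ℕ.* W) * + suc d       ≡⟨ cong (_* + suc d) (ℤP.pos-* Q W) ⟩
        (+ Q * + W) * + suc d       ∎

  frac-2 : ∀ d → frac 2 (suc d) ≡ ι (+ 2) ℚ.* frac 1 (suc d)
  frac-2 d = trans (frac-product 2 (suc d) 1 (suc d) 2 (s≤s z≤n) (s≤s z≤n) refl)
                   (ℚP.*-comm (frac 1 (suc d)) (ι (+ 2)))

  binomℚ≡ι : ∀ a k → binomℚ a k ≡ ι (Cℤ a k)
  binomℚ≡ι a (+ k)    = cong (λ x → ι (+ x)) (sym (bin≡C a k))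
  binomℚ≡ι a -[1+ k ] = refl

  sum1to-∑ : ∀ K (f : ℕ → ℚ) (c : ℚ) (h : ℕ → ℤ) → (∀ i → i < K → f (suc i) ≡ c ℚ.* ι (h i)) →
             sum1to K f ≡ c ℚ.* ι (∑ K h)
  sum1to-∑ zero    f c h _    = sym (ℚP.*-zeroʳ c)
  sum1to-∑ (suc K) f c h term = begin
      sum1to K f ℚ.+ f (suc K)
    ≡⟨ cong₂ ℚ._+_ (sum1to-∑ K f c h (λ i i<K → term i (ℕP.m<n⇒m<1+n i<K))) (term K ℕP.≤-refl) ⟩
      c ℚ.* ι (∑ K h) ℚ.+ c ℚ.* ι (h K)
    ≡⟨ sym (ℚP.*-distribˡ-+ c (ι (∑ K h)) (ι (h K))) ⟩
      c ℚ.* (ι (∑ K h) ℚ.+ ι (h K))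
    ≡⟨ cong (c ℚ.*_) (sym (ι-+ (∑ K h) (h K))) ⟩
      c ℚ.* ι (∑ K h + h K) ∎

  -- (a!)³ / (3a)!, the factor relating C(a, i)/C(3a, a+i) to the weight w_i.
  cube-ratio : ℕ → ℚ
  cube-ratio a = frac (a ! ℕ.* a ! ℕ.* a !) ((a ℕ.+ a ℕ.+ a) !)

  weight-ratio : ∀ a i → i ≤ a → frac (bin a i) (bin (a ℕ.+ a ℕ.+ a) (a ℕ.+ i)) ≡ cube-ratio a ℚ.* ι (weight a i)
  weight-ratio a i i≤a with ℕP.m≤n⇒∃[o]m+o≡n i≤a
  ... | c , refl = trans
     (frac-product (bin a i) (bin (a ℕ.+ a ℕ.+ a) (a ℕ.+ i)) (a ! ℕ.* a ! ℕ.* a !) ((a ℕ.+ a ℕ.+ a) !) W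
                   (bin-positive (a ℕ.+ a ℕ.+ a) (a ℕ.+ i) a+i≤3a) (ℕP.1≤n! (a ℕ.+ a ℕ.+ a))
                   (subst (λ x → bin a i ℕ.* (a ℕ.+ a ℕ.+ a) ! ≡ (a ! ℕ.* a ! ℕ.* a !) ℕ.* (bin (a ℕ.+ i) i ℕ.* bin x a)
                                   ℕ.* bin (a ℕ.+ a ℕ.+ a) (a ℕ.+ i))
                          (sym (double-∸ a i c refl)) (binomial-ratio i c)))
     (cong (λ x → cube-ratio a ℚ.* ι x) (ℤP.pos-* (bin (a ℕ.+ i) i) (bin (a ℕ.+ a ∸ i) a)))
    where
    W = bin (a ℕ.+ i) i ℕ.* bin (a ℕ.+ a ∸ i) a
    a+i≤3a : a ℕ.+ i ≤ a ℕ.+ a ℕ.+ a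
    a+i≤3a = ℕP.≤-trans (ℕP.+-monoʳ-≤ a (ℕP.m≤m+n i c)) (ℕP.m≤m+n (a ℕ.+ a) a)

module RationalForm (p m : ℕ) where
  open import Data.Nat using (suc; _<_; _!; _^_)
  open import Data.Integer using (ℤ; _+_; _*_; _-_)
  open import Data.Nat.Combinatorics using (_C_)
  open import Data.Rational.Solver using (module +-*-Solver)
  open IntegerForm p m
  open ≡-Reasoning

  κ : ℚ
  κ = (frac 1 (6 ℕ.* n ℕ.+ 1) ℚ.* frac ((4 ℕ.* n ℕ.+ 1) !) (((2 ℕ.* n) !) ^ 2)) ℚ.* cube-ratio N

  left-term right-term : ℕ → ℚ
  left-term j = α n j ℚ.*
    (binomℚ (6 ℕ.* n) (zsub m (4 ℕ.* n) ℤ.+ + j)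
     ℚ.- binomℚ (2 ℕ.* n ℕ.+ j ∸ 2) (zsub m (4 ℕ.* n) ℤ.+ + j)
     ℚ.- binomℚ (4 ℕ.* n ∸ j) (zsub m (6 ℕ.* n)))
  right-term k = β n k ℚ.* binomℚ (6 ℕ.* n) (zsub m (4 ℕ.* n) ℤ.+ + (2 ℕ.* k))

  binomial-quotient : ∀ i → i ≤ N →
    frac ((2 ℕ.* n) C i) ((6 ℕ.* n) C (2 ℕ.* n ℕ.+ suc i ∸ 1)) ≡ cube-ratio N ℚ.* ι (weight N i)
  binomial-quotient i i≤N = trans (cong₂ frac numerator denominator) (weight-ratio N i i≤N)
    where
    numerator : (2 ℕ.* n) C i ≡ bin N i
    numerator = trans (cong (_C i) (twice n)) (sym (bin≡C N i))
    index : 2 ℕ.* n ℕ.+ suc i ∸ 1 ≡ N ℕ.+ i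
    index = trans (cong (λ z → z ℕ.+ suc i ∸ 1) (twice n)) (cong (_∸ 1) (ℕP.+-suc N i))
    denominator : (6 ℕ.* n) C (2 ℕ.* n ℕ.+ suc i ∸ 1) ≡ bin (N ℕ.+ N ℕ.+ N) (N ℕ.+ i)
    denominator = trans (cong₂ _C_ (six-times n) index) (sym (bin≡C (N ℕ.+ N ℕ.+ N) (N ℕ.+ i)))

  left-term-integral : ∀ i → i ≤ N → left-term (suc i) ≡ κ ℚ.* ι (weight N i * (B₁ i - B₂ i - B₃ i))
  left-term-integral i i≤N = begin
      left-term (suc i)
    ≡⟨ cong (α n (suc i) ℚ.*_) brackets ⟩
      (c ℚ.* frac ((2 ℕ.* n) C i) ((6 ℕ.* n) C (2 ℕ.* n ℕ.+ suc i ∸ 1))) ℚ.* ι (B₁ i - B₂ i - B₃ i)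
    ≡⟨ cong (λ x → (c ℚ.* x) ℚ.* ι (B₁ i - B₂ i - B₃ i)) (binomial-quotient i i≤N) ⟩
      (c ℚ.* (cube-ratio N ℚ.* ι (weight N i))) ℚ.* ι (B₁ i - B₂ i - B₃ i)
    ≡⟨ regroup c (cube-ratio N) (ι (weight N i)) (ι (B₁ i - B₂ i - B₃ i)) ⟩
      κ ℚ.* (ι (weight N i) ℚ.* ι (B₁ i - B₂ i - B₃ i))
    ≡⟨ cong (κ ℚ.*_) (sym (ι-* (weight N i) (B₁ i - B₂ i - B₃ i))) ⟩
      κ ℚ.* ι (weight N i * (B₁ i - B₂ i - B₃ i)) ∎
    where
    c = frac 1 (6 ℕ.* n ℕ.+ 1) ℚ.* frac ((4 ℕ.* n ℕ.+ 1) !) (((2 ℕ.* n) !) ^ 2)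
    regroup : ∀ (a b x y : ℚ) → (a ℚ.* (b ℚ.* x)) ℚ.* y ≡ (a ℚ.* b) ℚ.* (x ℚ.* y)
    regroup a b x y = trans (cong (ℚ._* y) (sym (ℚP.*-assoc a b x))) (ℚP.*-assoc (a ℚ.* b) x y)
    brackets : binomℚ (6 ℕ.* n) (A + + suc i) ℚ.- binomℚ (2 ℕ.* n ℕ.+ suc i ∸ 2) (A + + suc i)
               ℚ.- binomℚ (4 ℕ.* n ∸ suc i) (zsub m (6 ℕ.* n)) ≡ ι (B₁ i - B₂ i - B₃ i)
    brackets = trans (cong₂ ℚ._-_ (cong₂ ℚ._-_ (binomℚ≡ι (6 ℕ.* n) (A + + suc i))
                                                (binomℚ≡ι (2 ℕ.* n ℕ.+ suc i ∸ 2) (A + + suc i)))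
                                   (binomℚ≡ι (4 ℕ.* n ∸ suc i) (zsub m (6 ℕ.* n))))
                     (sym (trans (ι-- (B₁ i - B₂ i) (B₃ i)) (cong (ℚ._- ι (B₃ i)) (ι-- (B₁ i) (B₂ i)))))

  right-term-integral : ∀ k → k < n → right-term (suc k) ≡ κ ℚ.* ι ((+ 2 * weight N (suc (k ℕ.+ k))) * B₁ (suc (k ℕ.+ k)))
  right-term-integral k k<n = begin
      ((frac 2 (6 ℕ.* n ℕ.+ 1) ℚ.* f) ℚ.* frac ((2 ℕ.* n) C (2 ℕ.* suc k ∸ 1)) ((6 ℕ.* n) C (2 ℕ.* n ℕ.+ 2 ℕ.* suc k ∸ 1)))
        ℚ.* binomℚ (6 ℕ.* n) (A + + (2 ℕ.* suc k))
    ≡⟨ cong₂ (λ x y → ((frac 2 (6 ℕ.* n ℕ.+ 1) ℚ.* f) ℚ.* x) ℚ.* y) quotient binomial ⟩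
      ((frac 2 (6 ℕ.* n ℕ.+ 1) ℚ.* f) ℚ.* (cube-ratio N ℚ.* ι W)) ℚ.* ι B
    ≡⟨ cong (λ x → ((x ℚ.* f) ℚ.* (cube-ratio N ℚ.* ι W)) ℚ.* ι B) two ⟩
      (((ι (+ 2) ℚ.* e) ℚ.* f) ℚ.* (cube-ratio N ℚ.* ι W)) ℚ.* ι B
    ≡⟨ regroup (ι (+ 2)) e f (cube-ratio N) (ι W) (ι B) ⟩
      κ ℚ.* ((ι (+ 2) ℚ.* ι W) ℚ.* ι B)
    ≡⟨ cong (κ ℚ.*_) (sym (trans (ι-* (+ 2 * W) B) (cong (ℚ._* ι B) (ι-* (+ 2) W)))) ⟩
      κ ℚ.* ι ((+ 2 * W) * B) ∎
    where
    open +-*-Solver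
    e = frac 1 (6 ℕ.* n ℕ.+ 1)
    f = frac ((4 ℕ.* n ℕ.+ 1) !) (((2 ℕ.* n) !) ^ 2)
    W = weight N (suc (k ℕ.+ k))
    B = B₁ (suc (k ℕ.+ k))
    double-suc : ∀ k → 2 ℕ.* suc k ≡ suc (suc (k ℕ.+ k))
    double-suc = ℕSolver.solve-∀
    2k+2 = double-suc k
    quotient : frac ((2 ℕ.* n) C (2 ℕ.* suc k ∸ 1)) ((6 ℕ.* n) C (2 ℕ.* n ℕ.+ 2 ℕ.* suc k ∸ 1)) ≡ cube-ratio N ℚ.* ι W
    quotient = trans (cong₂ (λ x y → frac ((2 ℕ.* n) C x) ((6 ℕ.* n) C (2 ℕ.* n ℕ.+ y ∸ 1))) (cong (_∸ 1) 2k+2) 2k+2)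
                     (binomial-quotient (suc (k ℕ.+ k)) (ℕP.+-mono-≤ k<n (ℕP.<⇒≤ k<n)))
    binomial : binomℚ (6 ℕ.* n) (A + + (2 ℕ.* suc k)) ≡ ι B
    binomial = trans (binomℚ≡ι (6 ℕ.* n) (A + + (2 ℕ.* suc k))) (cong (λ z → ι (Cℤ (6 ℕ.* n) (A + + z))) 2k+2)
    two : frac 2 (6 ℕ.* n ℕ.+ 1) ≡ ι (+ 2) ℚ.* e
    two = trans (cong (frac 2) (ℕP.+-comm (6 ℕ.* n) 1))
                (trans (frac-2 (6 ℕ.* n)) (cong (λ z → ι (+ 2) ℚ.* frac 1 z) (ℕP.+-comm 1 (6 ℕ.* n))))
    regroup : ∀ (t e f F x b : ℚ) → (((t ℚ.* e) ℚ.* f) ℚ.* (F ℚ.* x)) ℚ.* b ≡ ((e ℚ.* f) ℚ.* F) ℚ.* ((t ℚ.* x) ℚ.* b)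
    regroup = solve 6 (λ t e f F x b → (((t :* e) :* f) :* (F :* x)) :* b := ((e :* f) :* F) :* ((t :* x) :* b)) refl

-- With N = 2n, α_{n,i+1} = κ w_i and β_{n,k+1} = 2κ w_{2k+1}, so both sides are κ times
-- the two sides of the integer identity.

lemma2p3 : (n m : ℕ) → 1 ≤ n → 2 ℕ.* n ≤ m → m ≤ 10 ℕ.* n ∸ 2 →
    sum1to (2 ℕ.* n ℕ.+ 1) (λ j → α n j ℚ.*
    (binomℚ (6 ℕ.* n) (zsub m (4 ℕ.* n) ℤ.+ + j)
    ℚ.- binomℚ (2 ℕ.* n ℕ.+ j ∸ 2) (zsub m (4 ℕ.* n) ℤ.+ + j)
    ℚ.- binomℚ (4 ℕ.* n ∸ j) (zsub m (6 ℕ.* n))))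
    ≡ sum1to n (λ k → β n k ℚ.* binomℚ (6 ℕ.* n) (zsub m (4 ℕ.* n) ℤ.+ + (2 ℕ.* k)))
lemma2p3 ℕ.zero    m () _ _
lemma2p3 (ℕ.suc p) m _  _ _ = begin
    sum1to (2 ℕ.* n ℕ.+ 1) left-term
  ≡⟨ sum1to-∑ (2 ℕ.* n ℕ.+ 1) left-term κ left (λ i i<2n+1 → left-term-integral i (i≤N i<2n+1)) ⟩
    κ ℚ.* ι (∑ (2 ℕ.* n ℕ.+ 1) left)
  ≡⟨ cong (λ K → κ ℚ.* ι (∑ K left)) 2n+1≡1+N ⟩
    κ ℚ.* ι (∑ (ℕ.suc N) left)
  ≡⟨ cong (λ z → κ ℚ.* ι z) integer-identity ⟩
    κ ℚ.* ι (∑ n right)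
  ≡⟨ sym (sum1to-∑ n right-term κ right right-term-integral) ⟩
    sum1to n right-term ∎
  where
  open IntegerForm p m
  open RationalForm p m
  open ≡-Reasoning
  left right : ℕ → ℤ.ℤ
  left i  = weight N i ℤ.* (B₁ i ℤ.- B₂ i ℤ.- B₃ i)
  right k = (+ 2 ℤ.* weight N (ℕ.suc (k ℕ.+ k))) ℤ.* B₁ (ℕ.suc (k ℕ.+ k))
  2n+1≡1+N : 2 ℕ.* n ℕ.+ 1 ≡ ℕ.suc N
  2n+1≡1+N = trans (ℕP.+-comm (2 ℕ.* n) 1) (cong ℕ.suc (twice n))
  i≤N : ∀ {i} → i ℕ.< 2 ℕ.* n ℕ.+ 1 → i ≤ N
  i≤N {i} i<2n+1 = i<1+n⇒i≤n (subst (i ℕ.<_) 2n+1≡1+N i<2n+1)
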